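{- Let $\Sigma$ be a finite signature with set of constants $C$, let $\Phi$ be a finite set of closed formulas in the language of $\Sigma$, and let $p$ be a consistent pair with $p^+\cup p^-\subseteq\mathrm{Cl}_C(\Phi)$. Then there exist a finite set of constants $D\supseteq C$ and a pair $q$ in the language of $\Sigma$ extended by the constants $D$, with $p^+\subseteq q^+$ and $p^-\subseteq q^-$, such that $q$ is $\mathrm{Cl}_D(\Phi)$-MCW and $\mathrm{md}(q^+)=\mathrm{md}(p^+)$.
   Context: Formulas and derivability $\varphi\vdash\psi$ are those of the calculus $\mathsf{QRC_1}$: over a signature of constants and relation symbols (no function symbols), formulas are built from $\top$ and atomic $S(t_0,\dots,t_{n-1})$ ($t_i$ variables or constants) by $\wedge$, $\Diamond$, $\forall x$; $\mathsf{QRC_1}$ has the axioms $\varphi\vdash\top$, $\varphi\vdash\varphi$, $\varphi\wedge\psi\vdash\varphi$, $\varphi\wedge\psi\vdash\psi$, $\Diamond\Diamond\varphi\vdash\Diamond\varphi$, $\Diamond\forall x\varphi\vdash\forall x\Diamond\varphi$, and the rules: from $\varphi\vdash\psi,\varphi\vdash\chi$ infer $\varphi\vdash\psi\wedge\chi$; from $\varphi\vdash\psi,\psi\vdash\chi$ infer $\varphi\vdash\chi$; from $\varphi\vdash\psi$ infer $\Diamond\varphi\vdash\Diamond\psi$; from $\varphi\vdash\psi$ infer $\varphi\vdash\forall x\psi$ ($x$ not free in $\varphi$); from $\varphi[x\leftarrow t]\vdash\psi$ infer $\forall x\varphi\vdash\psi$ ($t$ free for $x$ in $\varphi$); from $\varphi\vdash\psi$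 infer $\varphi[x\leftarrow t]\vdash\psi[x\leftarrow t]$ ($t$ free for $x$ in $\varphi,\psi$); from $\varphi[x\leftarrow c]\vdash\psi[x\leftarrow c]$ infer $\varphi\vdash\psi$ ($c$ not in $\varphi,\psi$). $\Gamma\vdash\varphi$ means $\gamma_0\wedge\dots\wedge\gamma_n\vdash\varphi$ for some $\gamma_i\in\Gamma$. A pair is $p=\langle p^+,p^-\rangle$ of sets of formulas. A $\Phi$-extension of $p$ is a pair $q$ with $p^\pm\subseteq q^\pm\subseteq\Phi$. $p$ is consistent if $p^+\not\vdash\delta$ for all $\delta\in p^-$. A pair inside $\Phi$ is $\Phi$-maximal consistent if it is consistent and has no consistent $\Phi$-extension other than itself. $p$ is fully witnessed if for every $\forall x\varphi\in p^-$ there is a constant $c$ with $\varphi[x\leftarrow c]\in p^-$. $p$ is $\Phi$-MCW if it is $\Phi$-maximal consistent and fully witnessed. Closure under a set of constants $C$: $\mathrm{Cl}_C(\top)=\{\top\}$; $\mathrm{Cl}_C(S(t_0,\dots,t_{n-1}))=\{S(t_0,\dots,t_{n-1}),\top\}$; $\mathrm{Cl}_C(\varphi\wedge\psi)=\{\varphi\wedge\psi\}\cup\mathrm{Cl}_C(\varphi)\cup\mathrm{Cl}_C(\psi)$; $\mathrm{Cl}_C(\Diamond\varphi)=\{\Diamond\varphi\}\cup\mathrm{Cl}_C(\varphi)$; $\mathrm{Cl}_C(\forall x\varphi)=\{\forall x\varphi\}\cup\bigcup_{c\in C}\mathrm{Cl}_C(\varphi[x\leftarrow c])$; for a set, $\mathrm{Cl}_C(\Gamma)=\bigcup_{\gamma\in\Gamma}\mathrm{Cl}_C(\gamma)$.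 Modal depth: $\mathrm{md}(\top)=\mathrm{md}(S(\dots))=0$, $\mathrm{md}(\psi\wedge\chi)=\max$, $\mathrm{md}(\forall x\psi)=\mathrm{md}(\psi)$, $\mathrm{md}(\Diamond\psi)=\mathrm{md}(\psi)+1$; for a finite set $\Gamma$, $\mathrm{md}(\Gamma)=\max_{\varphi\in\Gamma}\mathrm{md}(\varphi)$. -}

module Defs where

open import Data.Nat using (ℕ; suc; _⊔_; _≟_)
open import Data.Product using (Σ; ∃; _×_; _,_)
open import Data.List using (List; []; _∷_; foldr; map)
open import Data.List.Relation.Unary.All using (All)
open import Data.List.Membership.Propositional using (_∈_)
open import Data.Vec using (Vec)
import Data.Vec as Vec
import Data.Vec.Relation.Unary.All as VAll
import Data.Vec.Membership.Propositional as VMem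
open import Relation.Binary.PropositionalEquality using (_≡_; _≢_)
open import Relation.Nullary using (¬_; yes; no)

-- Syntax.  Variables and constants are named by natural numbers
-- (a countably infinite global supply of constants).  A relation
-- symbol is a name S together with its arity n.

data Term : Set where
  var   : ℕ → Term
  const : ℕ → Term

infixr 6 _∧_
data Formula : Set where
  ⊤ₒ   : Formula
  atom : (n : ℕ) → (S : ℕ) → Vec Term n → Formula
  _∧_  : Formula → Formula → Formula
  ◇_   : Formula → Formula
  ∀ₒ   : ℕ → Formula → Formula

substT : ℕ → Term → Term → Term
substT x t (var y) with x ≟ y
... | yes _ = t
... | no  _ = var y
substT x t (const c) = const c

_[_≔_] : Formula → ℕ → Term → Formula
⊤ₒ [ x ≔ t ] = ⊤ₒ
atom n S ts [ x ≔ t ] = atom n S (Vec.map (substT x t) ts)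
(φ ∧ ψ) [ x ≔ t ] = (φ [ x ≔ t ]) ∧ (ψ [ x ≔ t ])
(◇ φ) [ x ≔ t ] = ◇ (φ [ x ≔ t ])
∀ₒ y φ [ x ≔ t ] with x ≟ y
... | yes _ = ∀ₒ y φ
... | no  _ = ∀ₒ y (φ [ x ≔ t ])

data FreeIn (x : ℕ) : Formula → Set where
  f-atom : ∀ {n S ts} → var x VMem.∈ ts → FreeIn x (atom n S ts)
  f-∧l   : ∀ {φ ψ} → FreeIn x φ → FreeIn x (φ ∧ ψ)
  f-∧r   : ∀ {φ ψ} → FreeIn x ψ → FreeIn x (φ ∧ ψ)
  f-◇    : ∀ {φ} → FreeIn x φ → FreeIn x (◇ φ)
  f-∀    : ∀ {y φ} → x ≢ y → FreeIn x φ → FreeIn x (∀ₒ y φ)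

data ConstIn (c : ℕ) : Formula → Set where
  c-atom : ∀ {n S ts} → const c VMem.∈ ts → ConstIn c (atom n S ts)
  c-∧l   : ∀ {φ ψ} → ConstIn c φ → ConstIn c (φ ∧ ψ)
  c-∧r   : ∀ {φ ψ} → ConstIn c ψ → ConstIn c (φ ∧ ψ)
  c-◇    : ∀ {φ} → ConstIn c φ → ConstIn c (◇ φ)
  c-∀    : ∀ {y φ} → ConstIn c φ → ConstIn c (∀ₒ y φ)

data FreeFor (t : Term) (x : ℕ) : Formula → Set where
  ff-⊤       : FreeFor t x ⊤ₒ
  ff-atom    : ∀ {n S ts} → FreeFor t x (atom n S ts)
  ff-∧       : ∀ {φ ψ} → FreeFor t x φ → FreeFor t x ψ → FreeFor t x (φ ∧ ψ)
  ff-◇       : ∀ {φ} → FreeFor t x φ → FreeFor t x (◇ φ)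
  ff-∀-bound : ∀ {φ} → FreeFor t x (∀ₒ x φ)
  ff-∀-nofree : ∀ {y φ} → ¬ FreeIn x (∀ₒ y φ) → FreeFor t x (∀ₒ y φ)
  ff-∀       : ∀ {y φ} → t ≢ var y → FreeFor t x φ → FreeFor t x (∀ₒ y φ)

Closed : Formula → Set
Closed φ = ∀ x → ¬ FreeIn x φ

infix 4 _⊢_
data _⊢_ : Formula → Formula → Set where
  ax-⊤    : ∀ {φ} → φ ⊢ ⊤ₒ
  ax-id   : ∀ {φ} → φ ⊢ φ
  ax-∧l   : ∀ {φ ψ} → φ ∧ ψ ⊢ φ
  ax-∧r   : ∀ {φ ψ} → φ ∧ ψ ⊢ ψ
  ax-4    : ∀ {φ} → ◇ ◇ φ ⊢ ◇ φ
  ax-◇∀   : ∀ {x φ} → ◇ ∀ₒ x φ ⊢ ∀ₒ x (◇ φ)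
  r-∧     : ∀ {φ ψ χ} → φ ⊢ ψ → φ ⊢ χ → φ ⊢ ψ ∧ χ
  r-cut   : ∀ {φ ψ χ} → φ ⊢ ψ → ψ ⊢ χ → φ ⊢ χ
  r-◇     : ∀ {φ ψ} → φ ⊢ ψ → ◇ φ ⊢ ◇ ψ
  r-∀R    : ∀ {φ ψ x} → ¬ FreeIn x φ → φ ⊢ ψ → φ ⊢ ∀ₒ x ψ
  r-∀L    : ∀ {φ ψ x t} → FreeFor t x φ → φ [ x ≔ t ] ⊢ ψ → ∀ₒ x φ ⊢ ψ
  r-subst : ∀ {φ ψ x t} → FreeFor t x φ → FreeFor t x ψ →
            φ ⊢ ψ → φ [ x ≔ t ] ⊢ ψ [ x ≔ t ]
  r-const : ∀ {φ ψ x c} → ¬ ConstIn c φ → ¬ ConstIn c ψ →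
            φ [ x ≔ const c ] ⊢ ψ [ x ≔ const c ] → φ ⊢ ψ

-- Finite sets of formulas are lists; Γ ⊢ φ means γ₀ ∧ … ∧ γₙ ⊢ φ
-- for some (n ≥ 0) γᵢ ∈ Γ.

conj : Formula → List Formula → Formula
conj γ [] = γ
conj γ (δ ∷ δs) = γ ∧ conj δ δs

_⊆_ : List Formula → List Formula → Set
Γ ⊆ Δ = ∀ {φ} → φ ∈ Γ → φ ∈ Δ

infix 4 _⊢ˢ_
_⊢ˢ_ : List Formula → Formula → Set
Γ ⊢ˢ φ = Σ Formula λ γ → Σ (List Formula) λ γs →
           (γ ∈ Γ) × All (_∈ Γ) γs × (conj γ γs ⊢ φ)

record Pair : Set where
  constructor ⟨_,_⟩
  field
    pos : List Formula
    neg : List Formula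
open Pair public

_≤ₚ_ : Pair → Pair → Set
p ≤ₚ q = (pos p ⊆ pos q) × (neg p ⊆ neg q)

Inside : (Formula → Set) → Pair → Set
Inside Φ p = (∀ {φ} → φ ∈ pos p → Φ φ) × (∀ {φ} → φ ∈ neg p → Φ φ)

Consistent : Pair → Set
Consistent p = ∀ {δ} → δ ∈ neg p → ¬ (pos p ⊢ˢ δ)

-- Φ-maximal consistent: inside Φ, consistent, and every consistent
-- Φ-extension of p is p itself (as sets, i.e. contained in p).
MaxCons : (Formula → Set) → Pair → Set
MaxCons Φ p = Inside Φ p × Consistent p ×
              (∀ q → p ≤ₚ q → Inside Φ q → Consistent q → q ≤ₚ p)

FullyWitnessed : Pair → Set
FullyWitnessed p = ∀ {x φ} → ∀ₒ x φ ∈ neg p →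
                   Σ ℕ λ c → (φ [ x ≔ const c ]) ∈ neg p

MCW : (Formula → Set) → Pair → Set
MCW Φ p = MaxCons Φ p × FullyWitnessed p

-- Closure Cl_C, as the membership relation  ψ ∈Cl[ C ] φ  ⇔  ψ ∈ Cl_C(φ)

data _∈Cl[_]_ : Formula → List ℕ → Formula → Set where
  cl-self  : ∀ {C φ} → φ ∈Cl[ C ] φ
  cl-atom⊤ : ∀ {C n S ts} → ⊤ₒ ∈Cl[ C ] atom n S ts
  cl-∧l    : ∀ {C χ φ ψ} → χ ∈Cl[ C ] φ → χ ∈Cl[ C ] (φ ∧ ψ)
  cl-∧r    : ∀ {C χ φ ψ} → χ ∈Cl[ C ] ψ → χ ∈Cl[ C ] (φ ∧ ψ)
  cl-◇     : ∀ {C χ φ} → χ ∈Cl[ C ] φ → χ ∈Cl[ C ] (◇ φ)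
  cl-∀     : ∀ {C χ x φ c} → c ∈ C → χ ∈Cl[ C ] (φ [ x ≔ const c ]) →
             χ ∈Cl[ C ] (∀ₒ x φ)

Cl : List ℕ → List Formula → Formula → Set
Cl C Φ ψ = Σ Formula λ φ → (φ ∈ Φ) × (ψ ∈Cl[ C ] φ)

md : Formula → ℕ
md ⊤ₒ = 0
md (atom _ _ _) = 0
md (φ ∧ ψ) = md φ ⊔ md ψ
md (◇ φ) = suc (md φ)
md (∀ₒ _ φ) = md φ

mdˢ : List Formula → ℕ
mdˢ Γ = foldr _⊔_ 0 (map md Γ)

record Signature : Set where
  field
    consts : List ℕ
    rels   : List (ℕ × ℕ)   -- (name S, arity n)
open Signature public

data TermIn (D : List ℕ) : Term → Set where
  t-var   : ∀ {x} → TermIn D (var x)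
  t-const : ∀ {c} → c ∈ D → TermIn D (const c)

data InLang (R : List (ℕ × ℕ)) (D : List ℕ) : Formula → Set where
  l-⊤    : InLang R D ⊤ₒ
  l-atom : ∀ {n S ts} → (S , n) ∈ R → VAll.All (TermIn D) ts → InLang R D (atom n S ts)
  l-∧    : ∀ {φ ψ} → InLang R D φ → InLang R D ψ → InLang R D (φ ∧ ψ)
  l-◇    : ∀ {φ} → InLang R D φ → InLang R D (◇ φ)
  l-∀    : ∀ {x φ} → InLang R D φ → InLang R D (∀ₒ x φ)

-- The pair q is read off a finite Kripke model whose worlds are formulas: v sees u when ◇ u is
-- obtained from v, possibly repeatedly, by ∧-elimination and instantiating ∀ with constants of D,
-- and an atom holds at v when it is obtained from v in this way.  Derivability is sound for this
-- model, truth in it is decidable, and a formula true at v has modal depth at most md v.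
-- Conversely a sentence ψ true at v is derivable from v as long as enough constants fresh for v
-- and ψ are available: ∀-introduction consumes one of them, and passing to a successor world
-- consumes one per instantiated quantifier, so qdepth v + qdepth ψ of them suffice.
-- With D = C plus 2k+1 fresh constants (k the quantifier depth of Φ) and v the conjunction of p⁺,
-- splitting Cl_D(Φ) into the formulas true and false at v gives q: it extends p by the truth lemma
-- and by completeness together with the consistency of p, it is maximal consistent because it
-- partitions Cl_D(Φ), it is fully witnessed because the domain is finite, and md q⁺ = md v = md p⁺.

module Submission where

open import Defs
open import Data.Empty using (⊥-elim)
open import Data.Fin using (Fin; zero)
import Data.Fin.Properties as Fin
open import Data.List using (List; []; _∷_; _++_; concatMap; filter; foldr; length; lookup; map; upTo)
open import Data.List.Membership.Propositional using (_∈_; _∉_; find; lose)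
open import Data.List.Membership.Propositional.Properties
  using (∈-++⁺ˡ; ∈-++⁺ʳ; ∈-++⁻; ∈-concatMap⁺; ∈-concatMap⁻; ∈-filter⁺; ∈-filter⁻; ∈-lookup; ∈-map⁻)
open import Data.List.Properties using (length-map; length-applyUpTo)
open import Data.List.Relation.Unary.All as All using (All; []; _∷_)
open import Data.List.Relation.Unary.All.Properties using (anti-mono)
open import Data.List.Relation.Unary.Any as Any using (Any; here; there; any?)
open import Data.List.Relation.Unary.Any.Properties using (lookup-index)
open import Data.List.Relation.Unary.AllPairs using ([]; _∷_)
open import Data.List.Relation.Unary.Unique.Propositional using (Unique)
import Data.List.Relation.Unary.Unique.Propositional.Properties as Unique
open import Data.Nat using (ℕ; zero; suc; _⊔_; _≟_; _+_; _≤_; _<_; z≤n; s≤s)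
open import Data.Nat.Properties
open import Data.List.Membership.DecPropositional _≟_ using (_∈?_)
open import Data.Product using (Σ; _×_; _,_; proj₁; proj₂; uncurry)
import Data.Product as Product
open import Data.Sum using (_⊎_; inj₁; inj₂; [_,_]′)
import Data.Sum as Sum
open import Data.Unit using (tt) renaming (⊤ to Unit)
open import Data.Vec using (Vec; []; _∷_)
import Data.Vec as Vec
import Data.Vec.Properties as Vec
import Data.Vec.Membership.Propositional as Vec
import Data.Vec.Relation.Unary.All as VAll
import Data.Vec.Relation.Unary.All.Properties as VAllP
open import Data.Vec.Relation.Unary.Any using (here; there)
import Data.Vec.Relation.Unary.Any.Properties as VAnyP
open import Function using (_∘_; id)
open import Relation.Binary using (DecidableEquality)
open import Relation.Binary.Construct.Closure.Transitive using (TransClosure; [_]; _∷_)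
import Relation.Binary.Construct.Closure.Transitive as Plus
open import Relation.Binary.PropositionalEquality
open import Relation.Nullary using (¬_; Dec; yes; no)
open import Relation.Nullary.Decidable using (map′; _×-dec_; _⊎-dec_; ¬?)

infix 4 _≟ₜ_ _≟ᶠ_

_≟ₜ_ : DecidableEquality Term
var x ≟ₜ var y = map′ (cong var) (λ { refl → refl }) (x ≟ y)
var x ≟ₜ const d = no λ ()
const c ≟ₜ var y = no λ ()
const c ≟ₜ const d = map′ (cong const) (λ { refl → refl }) (c ≟ d)

_≟ᶠ_ : DecidableEquality Formula
⊤ₒ ≟ᶠ ⊤ₒ = yes refl
atom n S ts ≟ᶠ atom m S′ us with n ≟ m
... | no n≢m = no λ { refl → n≢m refl }
... | yes refl = map′ (uncurry (cong₂ (atom n))) (λ { refl → refl , refl })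
                      (S ≟ S′ ×-dec Vec.≡-dec _≟ₜ_ ts us)
(φ ∧ ψ) ≟ᶠ (φ′ ∧ ψ′) = map′ (uncurry (cong₂ _∧_)) (λ { refl → refl , refl }) (φ ≟ᶠ φ′ ×-dec ψ ≟ᶠ ψ′)
◇ φ ≟ᶠ ◇ ψ = map′ (cong ◇_) (λ { refl → refl }) (φ ≟ᶠ ψ)
∀ₒ x φ ≟ᶠ ∀ₒ y ψ = map′ (uncurry (cong₂ ∀ₒ)) (λ { refl → refl , refl }) (x ≟ y ×-dec φ ≟ᶠ ψ)
⊤ₒ ≟ᶠ atom _ _ _ = no λ ()
⊤ₒ ≟ᶠ (_ ∧ _) = no λ ()
⊤ₒ ≟ᶠ ◇ _ = no λ ()
⊤ₒ ≟ᶠ ∀ₒ _ _ = no λ ()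
atom _ _ _ ≟ᶠ ⊤ₒ = no λ ()
atom _ _ _ ≟ᶠ (_ ∧ _) = no λ ()
atom _ _ _ ≟ᶠ ◇ _ = no λ ()
atom _ _ _ ≟ᶠ ∀ₒ _ _ = no λ ()
(_ ∧ _) ≟ᶠ ⊤ₒ = no λ ()
(_ ∧ _) ≟ᶠ atom _ _ _ = no λ ()
(_ ∧ _) ≟ᶠ ◇ _ = no λ ()
(_ ∧ _) ≟ᶠ ∀ₒ _ _ = no λ ()
◇ _ ≟ᶠ ⊤ₒ = no λ ()
◇ _ ≟ᶠ atom _ _ _ = no λ ()
◇ _ ≟ᶠ (_ ∧ _) = no λ ()
◇ _ ≟ᶠ ∀ₒ _ _ = no λ ()
∀ₒ _ _ ≟ᶠ ⊤ₒ = no λ ()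
∀ₒ _ _ ≟ᶠ atom _ _ _ = no λ ()
∀ₒ _ _ ≟ᶠ (_ ∧ _) = no λ ()
∀ₒ _ _ ≟ᶠ ◇ _ = no λ ()

size : Formula → ℕ
size ⊤ₒ = 1
size (atom _ _ _) = 1
size (φ ∧ ψ) = suc (size φ + size ψ)
size (◇ φ) = suc (size φ)
size (∀ₒ _ φ) = suc (size φ)

qdepth : Formula → ℕ
qdepth ⊤ₒ = 0
qdepth (atom _ _ _) = 0
qdepth (φ ∧ ψ) = qdepth φ ⊔ qdepth ψ
qdepth (◇ φ) = qdepth φ
qdepth (∀ₒ _ φ) = suc (qdepth φ)

size-pos : ∀ φ → 1 ≤ size φ
size-pos ⊤ₒ = s≤s z≤n
size-pos (atom _ _ _) = s≤s z≤n
size-pos (_ ∧ _) = s≤s z≤n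
size-pos (◇ _) = s≤s z≤n
size-pos (∀ₒ _ _) = s≤s z≤n

size-[≔] : ∀ φ x t → size (φ [ x ≔ t ]) ≡ size φ
size-[≔] ⊤ₒ x t = refl
size-[≔] (atom n S ts) x t = refl
size-[≔] (φ ∧ ψ) x t = cong₂ (λ a b → suc (a + b)) (size-[≔] φ x t) (size-[≔] ψ x t)
size-[≔] (◇ φ) x t = cong suc (size-[≔] φ x t)
size-[≔] (∀ₒ y φ) x t with x ≟ y
... | yes _ = refl
... | no _ = cong suc (size-[≔] φ x t)

qdepth-[≔] : ∀ φ x t → qdepth (φ [ x ≔ t ]) ≡ qdepth φ
qdepth-[≔] ⊤ₒ x t = refl
qdepth-[≔] (atom n S ts) x t = refl
qdepth-[≔] (φ ∧ ψ) x t = cong₂ _⊔_ (qdepth-[≔] φ x t) (qdepth-[≔] ψ x t)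
qdepth-[≔] (◇ φ) x t = qdepth-[≔] φ x t
qdepth-[≔] (∀ₒ y φ) x t with x ≟ y
... | yes _ = refl
... | no _ = cong suc (qdepth-[≔] φ x t)

md-[≔] : ∀ φ x t → md (φ [ x ≔ t ]) ≡ md φ
md-[≔] ⊤ₒ x t = refl
md-[≔] (atom n S ts) x t = refl
md-[≔] (φ ∧ ψ) x t = cong₂ _⊔_ (md-[≔] φ x t) (md-[≔] ψ x t)
md-[≔] (◇ φ) x t = cong suc (md-[≔] φ x t)
md-[≔] (∀ₒ y φ) x t with x ≟ y
... | yes _ = refl
... | no _ = md-[≔] φ x t

size-instance< : ∀ φ x c → size (φ [ x ≔ const c ]) < size (∀ₒ x φ)
size-instance< φ x c = s≤s (≤-reflexive (size-[≔] φ x (const c)))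

map-substT-fresh : ∀ {n x t} (ts : Vec Term n) → ¬ var x Vec.∈ ts → Vec.map (substT x t) ts ≡ ts
map-substT-fresh [] x∉ts = refl
map-substT-fresh {x = x} (var y ∷ ts) x∉ts with x ≟ y
... | yes refl = ⊥-elim (x∉ts (here refl))
... | no _ = cong (var y ∷_) (map-substT-fresh ts (x∉ts ∘ there))
map-substT-fresh (const c ∷ ts) x∉ts = cong (const c ∷_) (map-substT-fresh ts (x∉ts ∘ there))

[≔]-fresh : ∀ φ {x t} → ¬ FreeIn x φ → φ [ x ≔ t ] ≡ φ
[≔]-fresh ⊤ₒ x∉φ = refl
[≔]-fresh (atom n S ts) x∉φ = cong (atom n S) (map-substT-fresh ts (x∉φ ∘ f-atom))
[≔]-fresh (φ ∧ ψ) x∉φ = cong₂ _∧_ ([≔]-fresh φ (x∉φ ∘ f-∧l)) ([≔]-fresh ψ (x∉φ ∘ f-∧r))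
[≔]-fresh (◇ φ) x∉φ = cong ◇_ ([≔]-fresh φ (x∉φ ∘ f-◇))
[≔]-fresh (∀ₒ y φ) {x} x∉φ with x ≟ y
... | yes _ = refl
... | no x≢y = cong (∀ₒ y) ([≔]-fresh φ (x∉φ ∘ f-∀ x≢y))

const-freeFor : ∀ φ {c x} → FreeFor (const c) x φ
const-freeFor ⊤ₒ = ff-⊤
const-freeFor (atom n S x) = ff-atom
const-freeFor (φ ∧ ψ) = ff-∧ (const-freeFor φ) (const-freeFor ψ)
const-freeFor (◇ φ) = ff-◇ (const-freeFor φ)
const-freeFor (∀ₒ y φ) = ff-∀ (λ ()) (const-freeFor φ)

substT-const≡var : ∀ {x c y} u → var y ≡ substT x (const c) u → u ≡ var y × y ≢ x
substT-const≡var {x = x} (var z) e with x ≟ z | e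
... | yes _ | ()
... | no x≢z | refl = refl , x≢z ∘ sym
substT-const≡var (const d) ()

substT-const≡const : ∀ {x c d} u → const d ≡ substT x (const c) u → u ≡ const d ⊎ d ≡ c
substT-const≡const {x = x} (var z) e with x ≟ z | e
... | yes _ | refl = inj₂ refl
... | no _ | ()
substT-const≡const (const d) refl = inj₁ refl

var-∈-map-substT-const : ∀ {n x c y} (ts : Vec Term n) →
  var y Vec.∈ Vec.map (substT x (const c)) ts → var y Vec.∈ ts × y ≢ x
var-∈-map-substT-const ts y∈ with Vec.find (VAnyP.map⁻ y∈)
... | u , u∈ts , e with substT-const≡var u e
...   | refl , y≢x = u∈ts , y≢x

const-∈-map-substT-const : ∀ {n x c d} (ts : Vec Term n) →
  const d Vec.∈ Vec.map (substT x (const c)) ts → const d Vec.∈ ts ⊎ d ≡ c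
const-∈-map-substT-const ts d∈ with Vec.find (VAnyP.map⁻ d∈)
... | u , u∈ts , e = Sum.map₁ (λ { refl → u∈ts }) (substT-const≡const u e)

FreeIn-[≔const] : ∀ φ {x c y} → FreeIn y (φ [ x ≔ const c ]) → FreeIn y φ × y ≢ x
FreeIn-[≔const] (atom n S ts) (f-atom y∈) = Product.map₁ f-atom (var-∈-map-substT-const ts y∈)
FreeIn-[≔const] (φ ∧ ψ) (f-∧l y∈) = Product.map₁ f-∧l (FreeIn-[≔const] φ y∈)
FreeIn-[≔const] (φ ∧ ψ) (f-∧r y∈) = Product.map₁ f-∧r (FreeIn-[≔const] ψ y∈)
FreeIn-[≔const] (◇ φ) (f-◇ y∈) = Product.map₁ f-◇ (FreeIn-[≔const] φ y∈)
FreeIn-[≔const] (∀ₒ z φ) {x} y∈ with x ≟ z | y∈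
... | yes refl | f-∀ y≢x y∈φ = f-∀ y≢x y∈φ , y≢x
... | no _ | f-∀ y≢z y∈φ = Product.map₁ (f-∀ y≢z) (FreeIn-[≔const] φ y∈φ)

Closed-[≔const] : ∀ {x φ} c → Closed (∀ₒ x φ) → Closed (φ [ x ≔ const c ])
Closed-[≔const] {x} {φ} c closed y y∈ = let y∈φ , y≢x = FreeIn-[≔const] φ y∈ in closed y (f-∀ y≢x y∈φ)

ConstIn-[≔const] : ∀ φ {x c d} → ConstIn d (φ [ x ≔ const c ]) → ConstIn d φ ⊎ d ≡ c
ConstIn-[≔const] (atom n S ts) (c-atom d∈) = Sum.map₁ c-atom (const-∈-map-substT-const ts d∈)
ConstIn-[≔const] (φ ∧ ψ) (c-∧l d∈) = Sum.map₁ c-∧l (ConstIn-[≔const] φ d∈)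
ConstIn-[≔const] (φ ∧ ψ) (c-∧r d∈) = Sum.map₁ c-∧r (ConstIn-[≔const] ψ d∈)
ConstIn-[≔const] (◇ φ) (c-◇ d∈) = Sum.map₁ c-◇ (ConstIn-[≔const] φ d∈)
ConstIn-[≔const] (∀ₒ z φ) {x} d∈ with x ≟ z | d∈
... | yes _ | d∈φ = inj₁ d∈φ
... | no _ | c-∀ d∈φ = Sum.map₁ c-∀ (ConstIn-[≔const] φ d∈φ)

ConstsIn : List ℕ → Formula → Set
ConstsIn D φ = ∀ {c} → ConstIn c φ → c ∈ D

ConstsIn-[≔const] : ∀ {D x φ c} → c ∈ D → ConstsIn D (∀ₒ x φ) → ConstsIn D (φ [ x ≔ const c ])
ConstsIn-[≔const] {φ = φ} c∈D cs d∈ = [ cs ∘ c-∀ , (λ { refl → c∈D }) ]′ (ConstIn-[≔const] φ d∈)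

ConstsIn-∧ : ∀ {D φ ψ} → ConstsIn D φ → ConstsIn D ψ → ConstsIn D (φ ∧ ψ)
ConstsIn-∧ φ-consts ψ-consts (c-∧l c∈) = φ-consts c∈
ConstsIn-∧ φ-consts ψ-consts (c-∧r c∈) = ψ-consts c∈

TermIn-substT : ∀ {D x c u} → c ∈ D → TermIn D u → TermIn D (substT x (const c) u)
TermIn-substT {x = x} {u = var z} c∈D t-var with x ≟ z
... | yes _ = t-const c∈D
... | no _ = t-var
TermIn-substT c∈D (t-const d∈D) = t-const d∈D

TermIn-mono : ∀ {C D u} → (∀ {c} → c ∈ C → c ∈ D) → TermIn C u → TermIn D u
TermIn-mono C⊆D t-var = t-var
TermIn-mono C⊆D (t-const c∈C) = t-const (C⊆D c∈C)

InLang-mono : ∀ {R C D φ} → (∀ {c} → c ∈ C → c ∈ D) → InLang R C φ → InLang R D φ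
InLang-mono C⊆D l-⊤ = l-⊤
InLang-mono C⊆D (l-atom S∈R ts) = l-atom S∈R (VAll.map (TermIn-mono C⊆D) ts)
InLang-mono C⊆D (l-∧ φ ψ) = l-∧ (InLang-mono C⊆D φ) (InLang-mono C⊆D ψ)
InLang-mono C⊆D (l-◇ φ) = l-◇ (InLang-mono C⊆D φ)
InLang-mono C⊆D (l-∀ φ) = l-∀ (InLang-mono C⊆D φ)

InLang-[≔const] : ∀ {R D} φ {x c} → c ∈ D → InLang R D φ → InLang R D (φ [ x ≔ const c ])
InLang-[≔const] ⊤ₒ c∈D l-⊤ = l-⊤
InLang-[≔const] (atom n S ts) c∈D (l-atom S∈R ts∈) = l-atom S∈R (VAllP.map⁺ (VAll.map (TermIn-substT c∈D) ts∈))
InLang-[≔const] (φ ∧ ψ) c∈D (l-∧ φ∈ ψ∈) = l-∧ (InLang-[≔const] φ c∈D φ∈) (InLang-[≔const] ψ c∈D ψ∈)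
InLang-[≔const] (◇ φ) c∈D (l-◇ φ∈) = l-◇ (InLang-[≔const] φ c∈D φ∈)
InLang-[≔const] (∀ₒ y φ) {x} c∈D (l-∀ φ∈) with x ≟ y
... | yes _ = l-∀ φ∈
... | no _ = l-∀ (InLang-[≔const] φ c∈D φ∈)

InLang⇒ConstsIn : ∀ {R D φ} → InLang R D φ → ConstsIn D φ
InLang⇒ConstsIn (l-atom _ ts∈) (c-atom c∈ts) with VAll.lookup ts∈ c∈ts
... | t-const c∈D = c∈D
InLang⇒ConstsIn (l-∧ φ∈ ψ∈) (c-∧l c∈) = InLang⇒ConstsIn φ∈ c∈
InLang⇒ConstsIn (l-∧ φ∈ ψ∈) (c-∧r c∈) = InLang⇒ConstsIn ψ∈ c∈
InLang⇒ConstsIn (l-◇ φ∈) (c-◇ c∈) = InLang⇒ConstsIn φ∈ c∈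
InLang⇒ConstsIn (l-∀ φ∈) (c-∀ c∈) = InLang⇒ConstsIn φ∈ c∈

-- The closure Cl_C

∈Cl-trans : ∀ {C χ ψ φ} → χ ∈Cl[ C ] ψ → ψ ∈Cl[ C ] φ → χ ∈Cl[ C ] φ
∈Cl-trans χ∈ψ cl-self = χ∈ψ
∈Cl-trans cl-self cl-atom⊤ = cl-atom⊤
∈Cl-trans χ∈ψ (cl-∧l ψ∈φ) = cl-∧l (∈Cl-trans χ∈ψ ψ∈φ)
∈Cl-trans χ∈ψ (cl-∧r ψ∈φ) = cl-∧r (∈Cl-trans χ∈ψ ψ∈φ)
∈Cl-trans χ∈ψ (cl-◇ ψ∈φ) = cl-◇ (∈Cl-trans χ∈ψ ψ∈φ)
∈Cl-trans χ∈ψ (cl-∀ c∈C ψ∈φ) = cl-∀ c∈C (∈Cl-trans χ∈ψ ψ∈φ)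

∈Cl-mono : ∀ {C D ψ φ} → (∀ {c} → c ∈ C → c ∈ D) → ψ ∈Cl[ C ] φ → ψ ∈Cl[ D ] φ
∈Cl-mono C⊆D cl-self = cl-self
∈Cl-mono C⊆D cl-atom⊤ = cl-atom⊤
∈Cl-mono C⊆D (cl-∧l h) = cl-∧l (∈Cl-mono C⊆D h)
∈Cl-mono C⊆D (cl-∧r h) = cl-∧r (∈Cl-mono C⊆D h)
∈Cl-mono C⊆D (cl-◇ h) = cl-◇ (∈Cl-mono C⊆D h)
∈Cl-mono C⊆D (cl-∀ c∈C h) = cl-∀ (C⊆D c∈C) (∈Cl-mono C⊆D h)

∈Cl-closed : ∀ {C ψ φ} → ψ ∈Cl[ C ] φ → Closed φ → Closed ψ
∈Cl-closed cl-self closed = closed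
∈Cl-closed cl-atom⊤ closed y ()
∈Cl-closed (cl-∧l h) closed = ∈Cl-closed h (λ y → closed y ∘ f-∧l)
∈Cl-closed (cl-∧r h) closed = ∈Cl-closed h (λ y → closed y ∘ f-∧r)
∈Cl-closed (cl-◇ h) closed = ∈Cl-closed h (λ y → closed y ∘ f-◇)
∈Cl-closed (cl-∀ {c = c} _ h) closed = ∈Cl-closed h (Closed-[≔const] c closed)

∈Cl-ConstsIn : ∀ {D ψ φ} → ψ ∈Cl[ D ] φ → ConstsIn D φ → ConstsIn D ψ
∈Cl-ConstsIn cl-self cs = cs
∈Cl-ConstsIn cl-atom⊤ cs ()
∈Cl-ConstsIn (cl-∧l h) cs = ∈Cl-ConstsIn h (cs ∘ c-∧l)
∈Cl-ConstsIn (cl-∧r h) cs = ∈Cl-ConstsIn h (cs ∘ c-∧r)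
∈Cl-ConstsIn (cl-◇ h) cs = ∈Cl-ConstsIn h (cs ∘ c-◇)
∈Cl-ConstsIn (cl-∀ {φ = φ} c∈D h) cs = ∈Cl-ConstsIn h (ConstsIn-[≔const] {φ = φ} c∈D cs)

∈Cl-InLang : ∀ {R D ψ φ} → ψ ∈Cl[ D ] φ → InLang R D φ → InLang R D ψ
∈Cl-InLang cl-self φ∈ = φ∈
∈Cl-InLang cl-atom⊤ φ∈ = l-⊤
∈Cl-InLang (cl-∧l h) (l-∧ φ∈ _) = ∈Cl-InLang h φ∈
∈Cl-InLang (cl-∧r h) (l-∧ _ ψ∈) = ∈Cl-InLang h ψ∈
∈Cl-InLang (cl-◇ h) (l-◇ φ∈) = ∈Cl-InLang h φ∈
∈Cl-InLang (cl-∀ {φ = φ} c∈D h) (l-∀ φ∈) = ∈Cl-InLang h (InLang-[≔const] φ c∈D φ∈)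

∈Cl-size : ∀ {C ψ φ} → ψ ∈Cl[ C ] φ → size ψ ≤ size φ
∈Cl-size cl-self = ≤-refl
∈Cl-size cl-atom⊤ = ≤-refl
∈Cl-size (cl-∧l h) = ≤-trans (∈Cl-size h) (≤-trans (m≤m+n _ _) (n≤1+n _))
∈Cl-size (cl-∧r h) = ≤-trans (∈Cl-size h) (≤-trans (m≤n+m _ _) (n≤1+n _))
∈Cl-size (cl-◇ h) = ≤-trans (∈Cl-size h) (n≤1+n _)
∈Cl-size (cl-∀ {x = x} {φ} {c} _ h) = ≤-trans (∈Cl-size h) (<⇒≤ (size-instance< φ x c))

∈Cl-qdepth : ∀ {C ψ φ} → ψ ∈Cl[ C ] φ → qdepth ψ ≤ qdepth φ
∈Cl-qdepth cl-self = ≤-refl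
∈Cl-qdepth cl-atom⊤ = z≤n
∈Cl-qdepth (cl-∧l h) = ≤-trans (∈Cl-qdepth h) (m≤m⊔n _ _)
∈Cl-qdepth (cl-∧r h) = ≤-trans (∈Cl-qdepth h) (m≤n⊔m _ _)
∈Cl-qdepth (cl-◇ h) = ∈Cl-qdepth h
∈Cl-qdepth (cl-∀ {x = x} {φ} {c} _ h) =
  ≤-trans (∈Cl-qdepth h) (≤-trans (≤-reflexive (qdepth-[≔] φ x (const c))) (n≤1+n _))

∈Cl-md : ∀ {C ψ φ} → ψ ∈Cl[ C ] φ → md ψ ≤ md φ
∈Cl-md cl-self = ≤-refl
∈Cl-md cl-atom⊤ = z≤n
∈Cl-md (cl-∧l h) = ≤-trans (∈Cl-md h) (m≤m⊔n _ _)
∈Cl-md (cl-∧r h) = ≤-trans (∈Cl-md h) (m≤n⊔m _ _)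
∈Cl-md (cl-◇ h) = ≤-trans (∈Cl-md h) (n≤1+n _)
∈Cl-md (cl-∀ {x = x} {φ} {c} _ h) = ≤-trans (∈Cl-md h) (≤-reflexive (md-[≔] φ x (const c)))

-- The closure as a list; the fuel n must be at least size φ.
mutual
  enumCl : List ℕ → ℕ → Formula → List Formula
  enumCl C zero φ = []
  enumCl C (suc n) φ = φ ∷ enumCl⁻ C n φ

  enumCl⁻ : List ℕ → ℕ → Formula → List Formula
  enumCl⁻ C n ⊤ₒ = []
  enumCl⁻ C n (atom _ _ _) = ⊤ₒ ∷ []
  enumCl⁻ C n (φ ∧ ψ) = enumCl C n φ ++ enumCl C n ψ
  enumCl⁻ C n (◇ φ) = enumCl C n φ
  enumCl⁻ C n (∀ₒ x φ) = concatMap (λ c → enumCl C n (φ [ x ≔ const c ])) C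

enumCl-sound : ∀ {C} n φ {ψ} → ψ ∈ enumCl C n φ → ψ ∈Cl[ C ] φ
enumCl-sound (suc n) φ (here refl) = cl-self
enumCl-sound (suc n) (atom _ _ _) (there (here refl)) = cl-atom⊤
enumCl-sound (suc n) (φ ∧ ψ) (there h) =
  [ cl-∧l ∘ enumCl-sound n φ , cl-∧r ∘ enumCl-sound n ψ ]′ (∈-++⁻ (enumCl _ n φ) h)
enumCl-sound (suc n) (◇ φ) (there h) = cl-◇ (enumCl-sound n φ h)
enumCl-sound {C} (suc n) (∀ₒ x φ) (there h) =
  let c , c∈C , h′ = find (∈-concatMap⁻ (λ c → enumCl C n (φ [ x ≔ const c ])) {C} h)
  in cl-∀ c∈C (enumCl-sound n _ h′)

enumCl-complete : ∀ {C} n {ψ φ} → ψ ∈Cl[ C ] φ → size φ ≤ n → ψ ∈ enumCl C n φ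
enumCl-complete zero {φ = φ} _ le with ≤-trans (size-pos φ) le
... | ()
enumCl-complete (suc n) cl-self le = here refl
enumCl-complete (suc n) cl-atom⊤ le = there (here refl)
enumCl-complete (suc n) (cl-∧l {φ = φ} {ψ} h) (s≤s le) =
  there (∈-++⁺ˡ (enumCl-complete n h (≤-trans (m≤m+n (size φ) (size ψ)) le)))
enumCl-complete (suc n) (cl-∧r {φ = φ} {ψ} h) (s≤s le) =
  there (∈-++⁺ʳ _ (enumCl-complete n h (≤-trans (m≤n+m (size ψ) (size φ)) le)))
enumCl-complete (suc n) (cl-◇ h) (s≤s le) = there (enumCl-complete n h le)
enumCl-complete {C} (suc n) (cl-∀ {x = x} {φ} {c} c∈C h) le =
  there (∈-concatMap⁺ (λ c → enumCl C n (φ [ x ≔ const c ]))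
    (lose c∈C (enumCl-complete n h (≤-pred (≤-trans (size-instance< φ x c) le)))))

enumClˢ : List ℕ → List Formula → List Formula
enumClˢ C Φ = concatMap (λ φ → enumCl C (size φ) φ) Φ

∈-enumClˢ⁻ : ∀ {C Φ ψ} → ψ ∈ enumClˢ C Φ → Cl C Φ ψ
∈-enumClˢ⁻ {C} {Φ} ψ∈ =
  let φ , φ∈Φ , ψ∈φ = find (∈-concatMap⁻ (λ φ → enumCl C (size φ) φ) {Φ} ψ∈)
  in φ , φ∈Φ , enumCl-sound _ φ ψ∈φ

∈-enumClˢ⁺ : ∀ {C Φ ψ} → Cl C Φ ψ → ψ ∈ enumClˢ C Φ
∈-enumClˢ⁺ {C} (φ , φ∈Φ , ψ∈φ) =
  ∈-concatMap⁺ (λ φ → enumCl C (size φ) φ) (lose φ∈Φ (enumCl-complete (size φ) ψ∈φ ≤-refl))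

record NewConstants (ψ φ : Formula) : Set where
  field
    new : List ℕ
    bound : length new + qdepth ψ ≤ qdepth φ
    cover : ∀ {c} → ConstIn c ψ → ConstIn c φ ⊎ c ∈ new

∈Cl-newConstants : ∀ {C ψ φ} → ψ ∈Cl[ C ] φ → NewConstants ψ φ
∈Cl-newConstants cl-self = record { new = [] ; bound = ≤-refl ; cover = inj₁ }
∈Cl-newConstants cl-atom⊤ = record { new = [] ; bound = z≤n ; cover = λ () }
∈Cl-newConstants (cl-∧l h) = let open NewConstants (∈Cl-newConstants h) in
  record { new = new ; bound = ≤-trans bound (m≤m⊔n _ _) ; cover = Sum.map₁ c-∧l ∘ cover }
∈Cl-newConstants (cl-∧r h) = let open NewConstants (∈Cl-newConstants h) in
  record { new = new ; bound = ≤-trans bound (m≤n⊔m _ _) ; cover = Sum.map₁ c-∧r ∘ cover }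
∈Cl-newConstants (cl-◇ h) = let open NewConstants (∈Cl-newConstants h) in
  record { new = new ; bound = bound ; cover = Sum.map₁ c-◇ ∘ cover }
∈Cl-newConstants (cl-∀ {x = x} {φ} {c} _ h) = let open NewConstants (∈Cl-newConstants h) in
  record { new = c ∷ new
         ; bound = s≤s (≤-trans bound (≤-reflexive (qdepth-[≔] φ x (const c))))
         ; cover = [ [ inj₁ ∘ c-∀ , (λ { refl → inj₂ (here refl) }) ]′ ∘ ConstIn-[≔const] φ
                   , inj₂ ∘ there ]′ ∘ cover }

delete : ℕ → List ℕ → List ℕ
delete c [] = []
delete c (f ∷ fs) with f ≟ c
... | yes _ = fs
... | no _ = f ∷ delete c fs

_∖_ : List ℕ → List ℕ → List ℕ
fs ∖ [] = fs
fs ∖ (c ∷ cs) = delete c fs ∖ cs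

∈-delete⁻ : ∀ {c g} fs → g ∈ delete c fs → g ∈ fs
∈-delete⁻ {c} (f ∷ fs) g∈ with f ≟ c | g∈
... | yes _ | g∈fs = there g∈fs
... | no _ | here g≡f = here g≡f
... | no _ | there g∈fs = there (∈-delete⁻ fs g∈fs)

length-delete : ∀ c fs → length fs ≤ suc (length (delete c fs))
length-delete c [] = z≤n
length-delete c (f ∷ fs) with f ≟ c
... | yes _ = ≤-refl
... | no _ = s≤s (length-delete c fs)

delete⁺ : ∀ {c fs} → Unique fs → Unique (delete c fs)
delete⁺ [] = []
delete⁺ {c} {f ∷ fs} (f∉fs ∷ fs!) with f ≟ c
... | yes _ = fs!
... | no _ = anti-mono (∈-delete⁻ fs) f∉fs ∷ delete⁺ fs!

∉-delete : ∀ {c fs} → Unique fs → c ∉ delete c fs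
∉-delete {c} {f ∷ fs} (f∉fs ∷ fs!) c∈ with f ≟ c | c∈
... | yes refl | c∈fs = All.lookup f∉fs c∈fs refl
... | no f≢c | here refl = f≢c refl
... | no _ | there c∈fs = ∉-delete fs! c∈fs

∈-∖⁻ : ∀ {g} fs cs → g ∈ fs ∖ cs → g ∈ fs
∈-∖⁻ fs [] g∈ = g∈
∈-∖⁻ fs (c ∷ cs) g∈ = ∈-delete⁻ fs (∈-∖⁻ (delete c fs) cs g∈)

length-∖ : ∀ fs cs → length fs ≤ length cs + length (fs ∖ cs)
length-∖ fs [] = ≤-refl
length-∖ fs (c ∷ cs) = ≤-trans (length-delete c fs) (s≤s (length-∖ (delete c fs) cs))

∖⁺ : ∀ {fs} cs → Unique fs → Unique (fs ∖ cs)
∖⁺ [] fs! = fs!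
∖⁺ (c ∷ cs) fs! = ∖⁺ cs (delete⁺ fs!)

∉-∖ : ∀ {g fs} cs → Unique fs → g ∈ fs ∖ cs → g ∉ cs
∉-∖ {fs = fs} (c ∷ cs) fs! g∈ (here refl) = ∉-delete fs! (∈-∖⁻ (delete c fs) cs g∈)
∉-∖ (c ∷ cs) fs! g∈ (there g∈cs) = ∉-∖ cs (delete⁺ fs!) g∈ g∈cs

freshFrom : ℕ → ℕ → List ℕ
freshFrom N k = map (N +_) (upTo k)

freshFrom-≥ : ∀ {N k f} → f ∈ freshFrom N k → N ≤ f
freshFrom-≥ {N} f∈ with ∈-map⁻ (N +_) f∈
... | i , _ , refl = m≤m+n N i

freshFrom-unique : ∀ N k → Unique (freshFrom N k)
freshFrom-unique N k = Unique.map⁺ (+-cancelˡ-≡ N _ _) (Unique.upTo⁺ k)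

length-freshFrom : ∀ N k → length (freshFrom N k) ≡ k
length-freshFrom N k = trans (length-map (N +_) (upTo k)) (length-applyUpTo _ k)

maxOf : {A : Set} → (A → ℕ) → List A → ℕ
maxOf f xs = foldr _⊔_ 0 (map f xs)

≤-maxOf : ∀ {A : Set} (f : A → ℕ) {x xs} → x ∈ xs → f x ≤ maxOf f xs
≤-maxOf f {xs = y ∷ ys} (here refl) = m≤m⊔n (f y) (maxOf f ys)
≤-maxOf f {xs = y ∷ ys} (there x∈) = ≤-trans (≤-maxOf f x∈) (m≤n⊔m (f y) (maxOf f ys))

maxOf-lub : ∀ {A : Set} (f : A → ℕ) {k} xs → (∀ {x} → x ∈ xs → f x ≤ k) → maxOf f xs ≤ k
maxOf-lub f [] _ = z≤n
maxOf-lub f (x ∷ xs) ≤k = ⊔-lub (≤k (here refl)) (maxOf-lub f xs (≤k ∘ there))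

maxOf-mono : ∀ {A : Set} (f : A → ℕ) {xs ys} → (∀ {x} → x ∈ xs → x ∈ ys) → maxOf f xs ≤ maxOf f ys
maxOf-mono f {xs} xs⊆ys = maxOf-lub f xs (≤-maxOf f ∘ xs⊆ys)

conj-all : ∀ {P : Formula → Set} → (∀ {φ ψ} → P φ → P ψ → P (φ ∧ ψ)) →
  ∀ γ γs → (∀ {φ} → φ ∈ γ ∷ γs → P φ) → P (conj γ γs)
conj-all P∧ γ [] Pγs = Pγs (here refl)
conj-all P∧ γ (δ ∷ δs) Pγs = P∧ (Pγs (here refl)) (conj-all P∧ δ δs (Pγs ∘ there))

∈⇒⊢ˢ : ∀ {Γ φ} → φ ∈ Γ → Γ ⊢ˢ φ
∈⇒⊢ˢ φ∈Γ = _ , [] , φ∈Γ , [] , ax-id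

partition⇒maximal : ∀ {P : Formula → Set} q → (∀ {φ} → P φ → φ ∈ pos q ⊎ φ ∈ neg q) →
  ∀ r → q ≤ₚ r → Inside P r → Consistent r → r ≤ₚ q
partition⇒maximal q split r (q⁺⊆r⁺ , q⁻⊆r⁻) (r⁺⊆P , r⁻⊆P) r-consistent =
  (λ φ∈r⁺ → [ id , (λ φ∈q⁻ → ⊥-elim (r-consistent (q⁻⊆r⁻ φ∈q⁻) (∈⇒⊢ˢ φ∈r⁺))) ]′ (split (r⁺⊆P φ∈r⁺))) ,
  (λ φ∈r⁻ → [ (λ φ∈q⁺ → ⊥-elim (r-consistent φ∈r⁻ (∈⇒⊢ˢ (q⁺⊆r⁺ φ∈q⁺)))) , id ]′ (split (r⁻⊆P φ∈r⁻)))

-- Kripke semantics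

_[_↦_] : {A : Set} → (ℕ → A) → ℕ → A → ℕ → A
(ρ [ x ↦ d ]) y with x ≟ y
... | yes _ = d
... | no _ = ρ y

module _ {A : Set} where

  ↦-≡ : ∀ {ρ : ℕ → A} {x d z} → x ≡ z → (ρ [ x ↦ d ]) z ≡ d
  ↦-≡ {x = x} {z = z} x≡z with x ≟ z
  ... | yes _ = refl
  ... | no x≢z = ⊥-elim (x≢z x≡z)

  ↦-≢ : ∀ {ρ : ℕ → A} {x d z} → x ≢ z → (ρ [ x ↦ d ]) z ≡ ρ z
  ↦-≢ {x = x} {z = z} x≢z with x ≟ z
  ... | yes x≡z = ⊥-elim (x≢z x≡z)
  ... | no _ = refl

  ↦-shadow : ∀ {ρ : ℕ → A} {x d e} z → ((ρ [ x ↦ e ]) [ x ↦ d ]) z ≡ (ρ [ x ↦ d ]) z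
  ↦-shadow {x = x} z with x ≟ z
  ... | yes _ = refl
  ... | no x≢z = ↦-≢ x≢z

  ↦-self : ∀ {ρ : ℕ → A} {x} z → (ρ [ x ↦ ρ x ]) z ≡ ρ z
  ↦-self {x = x} z with x ≟ z
  ... | yes refl = refl
  ... | no _ = refl

  ↦-comm : ∀ {ρ : ℕ → A} {x y d e} → x ≢ y → ∀ z →
           ((ρ [ x ↦ e ]) [ y ↦ d ]) z ≡ ((ρ [ y ↦ d ]) [ x ↦ e ]) z
  ↦-comm {ρ} {x} {y} {d} {e} x≢y z = by-cases (x ≟ z) (y ≟ z)
    where
    by-cases : Dec (x ≡ z) → Dec (y ≡ z) → ((ρ [ x ↦ e ]) [ y ↦ d ]) z ≡ ((ρ [ y ↦ d ]) [ x ↦ e ]) z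
    by-cases (yes x≡z) (yes y≡z) = ⊥-elim (x≢y (trans x≡z (sym y≡z)))
    by-cases (yes x≡z) (no y≢z) = trans (↦-≢ y≢z) (trans (↦-≡ x≡z) (sym (↦-≡ x≡z)))
    by-cases (no x≢z) (yes y≡z) = trans (↦-≡ y≡z) (sym (trans (↦-≢ x≢z) (↦-≡ y≡z)))
    by-cases (no x≢z) (no y≢z) = trans (↦-≢ y≢z) (trans (↦-≢ x≢z) (sym (trans (↦-≢ x≢z) (↦-≢ y≢z))))

map-cong-∈ : ∀ {A B : Set} {n} {f g : A → B} (xs : Vec A n) →
  (∀ {u} → u Vec.∈ xs → f u ≡ g u) → Vec.map f xs ≡ Vec.map g xs
map-cong-∈ [] f≡g = refl
map-cong-∈ (u ∷ xs) f≡g = cong₂ _∷_ (f≡g (here refl)) (map-cong-∈ xs (f≡g ∘ there))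

record Model : Set₁ where
  field
    World : Set
    _≺_ : World → World → Set
    ≺-trans : ∀ {u v w} → u ≺ v → v ≺ w → u ≺ w
    Domain : Set
    V : World → (n S : ℕ) → Vec Domain n → Set

module Semantics (M : Model) where
  open Model M

  Env : Set
  Env = ℕ → Domain

  eval : (ℕ → Domain) → Env → Term → Domain
  eval I ρ (var x) = ρ x
  eval I ρ (const c) = I c

  Sat : (ℕ → Domain) → Formula → World → Env → Set
  Sat I ⊤ₒ w ρ = Unit
  Sat I (atom n S ts) w ρ = V w n S (Vec.map (eval I ρ) ts)
  Sat I (φ ∧ ψ) w ρ = Sat I φ w ρ × Sat I ψ w ρ
  Sat I (◇ φ) w ρ = Σ World λ u → w ≺ u × Sat I φ u ρ
  Sat I (∀ₒ x φ) w ρ = (d : Domain) → Sat I φ w (ρ [ x ↦ d ])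

  Sat-coincide : ∀ φ {I w ρ ρ′} → (∀ y → FreeIn y φ → ρ y ≡ ρ′ y) → Sat I φ w ρ → Sat I φ w ρ′
  Sat-coincide ⊤ₒ agree _ = tt
  Sat-coincide (atom n S ts) {I} {w} agree = subst (V w n S) (map-cong-∈ ts eval≡)
    where
    eval≡ : ∀ {u} → u Vec.∈ ts → eval I _ u ≡ eval I _ u
    eval≡ {var y} y∈ts = agree y (f-atom y∈ts)
    eval≡ {const c} _ = refl
  Sat-coincide (φ ∧ ψ) agree (φ⊨ , ψ⊨) =
    Sat-coincide φ (λ y → agree y ∘ f-∧l) φ⊨ , Sat-coincide ψ (λ y → agree y ∘ f-∧r) ψ⊨
  Sat-coincide (◇ φ) agree (u , w≺u , φ⊨) = u , w≺u , Sat-coincide φ (λ y → agree y ∘ f-◇) φ⊨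
  Sat-coincide (∀ₒ x φ) {ρ = ρ} {ρ′} agree φ⊨ d = Sat-coincide φ agree′ (φ⊨ d)
    where
    agree′ : ∀ y → FreeIn y φ → (ρ [ x ↦ d ]) y ≡ (ρ′ [ x ↦ d ]) y
    agree′ y y∈φ with x ≟ y
    ... | yes _ = refl
    ... | no x≢y = agree y (f-∀ (x≢y ∘ sym) y∈φ)

  Sat-≗ : ∀ φ {I w ρ ρ′} → (∀ y → ρ y ≡ ρ′ y) → Sat I φ w ρ → Sat I φ w ρ′
  Sat-≗ φ ρ≗ρ′ = Sat-coincide φ (λ y _ → ρ≗ρ′ y)

  eval-substT : ∀ {I ρ x t} u → eval I ρ (substT x t u) ≡ eval I (ρ [ x ↦ eval I ρ t ]) u
  eval-substT {x = x} (var y) with x ≟ y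
  ... | yes _ = refl
  ... | no _ = refl
  eval-substT (const c) = refl

  eval-↦ : ∀ {I ρ y d} t → t ≢ var y → eval I (ρ [ y ↦ d ]) t ≡ eval I ρ t
  eval-↦ (var z) t≢y = ↦-≢ (t≢y ∘ cong var ∘ sym)
  eval-↦ (const c) _ = refl

  Sat-[≔] : ∀ φ {x t I w ρ} → FreeFor t x φ →
    (Sat I (φ [ x ≔ t ]) w ρ → Sat I φ w (ρ [ x ↦ eval I ρ t ])) ×
    (Sat I φ w (ρ [ x ↦ eval I ρ t ]) → Sat I (φ [ x ≔ t ]) w ρ)
  Sat-[≔] ⊤ₒ _ = (λ _ → tt) , (λ _ → tt)
  Sat-[≔] (atom n S ts) {w = w} _ = subst (V w n S) eval≡ , subst (V w n S) (sym eval≡)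
    where eval≡ = trans (sym (Vec.map-∘ _ _ ts)) (Vec.map-cong eval-substT ts)
  Sat-[≔] (φ ∧ ψ) (ff-∧ φff ψff) =
    (λ (a , b) → proj₁ (Sat-[≔] φ φff) a , proj₁ (Sat-[≔] ψ ψff) b) ,
    (λ (a , b) → proj₂ (Sat-[≔] φ φff) a , proj₂ (Sat-[≔] ψ ψff) b)
  Sat-[≔] (◇ φ) (ff-◇ φff) =
    (λ (u , w≺u , a) → u , w≺u , proj₁ (Sat-[≔] φ φff) a) ,
    (λ (u , w≺u , a) → u , w≺u , proj₂ (Sat-[≔] φ φff) a)
  Sat-[≔] (∀ₒ y φ) {x} {t} {I} {w} {ρ} ff with x ≟ y | ff
  ... | yes refl | _ =
    (λ φ⊨ d → Sat-≗ φ (sym ∘ ↦-shadow {ρ = ρ} {x} {d} {eval I ρ t}) (φ⊨ d)) ,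
    (λ φ⊨ d → Sat-≗ φ (↦-shadow {ρ = ρ} {x} {d} {eval I ρ t}) (φ⊨ d))
  ... | no x≢y | ff-∀-bound = ⊥-elim (x≢y refl)
  ... | no x≢y | ff-∀-nofree x∉ rewrite [≔]-fresh φ {x} {t} (x∉ ∘ f-∀ x≢y) =
    (λ φ⊨ d → Sat-coincide φ (agree {d}) (φ⊨ d)) , (λ φ⊨ d → Sat-coincide φ (λ z → sym ∘ agree {d} z) (φ⊨ d))
    where
    agree : ∀ {d} z → FreeIn z φ → (ρ [ y ↦ d ]) z ≡ ((ρ [ x ↦ eval I ρ t ]) [ y ↦ d ]) z
    agree z z∈φ with y ≟ z
    ... | yes _ = refl
    ... | no _ = sym (↦-≢ {ρ = ρ} {x} {eval I ρ t} λ { refl → x∉ (f-∀ x≢y z∈φ) })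
  ... | no x≢y | ff-∀ t≢y φff =
    (λ φ⊨ d → Sat-≗ φ (λ z → trans (cong (λ e → ((ρ [ y ↦ d ]) [ x ↦ e ]) z) (eval-↦ t t≢y)) (sym (↦-comm x≢y z)))
                      (proj₁ (Sat-[≔] φ φff) (φ⊨ d))) ,
    (λ φ⊨ d → proj₂ (Sat-[≔] φ φff)
                (Sat-≗ φ (λ z → trans (↦-comm x≢y z) (cong (λ e → ((ρ [ y ↦ d ]) [ x ↦ e ]) z) (sym (eval-↦ t t≢y))))
                  (φ⊨ d)))

  Sat-[≔const] : ∀ φ {x c I w ρ} → Sat I (φ [ x ≔ const c ]) w ρ → Sat I φ w (ρ [ x ↦ I c ])
  Sat-[≔const] φ = proj₁ (Sat-[≔] φ (const-freeFor φ))

  Sat-const-irrelevant : ∀ φ {c I I′ w ρ} → ¬ ConstIn c φ → (∀ d → d ≢ c → I d ≡ I′ d) →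
    Sat I φ w ρ → Sat I′ φ w ρ
  Sat-const-irrelevant ⊤ₒ _ _ _ = tt
  Sat-const-irrelevant (atom n S ts) {c} {I} {I′} {w} c∉ I≡I′ = subst (V w n S) (map-cong-∈ ts eval≡)
    where
    eval≡ : ∀ {u} → u Vec.∈ ts → eval I _ u ≡ eval I′ _ u
    eval≡ {var y} _ = refl
    eval≡ {const d} d∈ts = I≡I′ d (λ { refl → c∉ (c-atom d∈ts) })
  Sat-const-irrelevant (φ ∧ ψ) c∉ I≡I′ (φ⊨ , ψ⊨) =
    Sat-const-irrelevant φ (c∉ ∘ c-∧l) I≡I′ φ⊨ , Sat-const-irrelevant ψ (c∉ ∘ c-∧r) I≡I′ ψ⊨
  Sat-const-irrelevant (◇ φ) c∉ I≡I′ (u , w≺u , φ⊨) = u , w≺u , Sat-const-irrelevant φ (c∉ ∘ c-◇) I≡I′ φ⊨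
  Sat-const-irrelevant (∀ₒ x φ) c∉ I≡I′ φ⊨ d = Sat-const-irrelevant φ (c∉ ∘ c-∀) I≡I′ (φ⊨ d)

  soundness : ∀ {φ ψ} → φ ⊢ ψ → ∀ I w ρ → Sat I φ w ρ → Sat I ψ w ρ
  soundness ax-⊤ I w ρ _ = tt
  soundness ax-id I w ρ φ⊨ = φ⊨
  soundness ax-∧l I w ρ (φ⊨ , _) = φ⊨
  soundness ax-∧r I w ρ (_ , ψ⊨) = ψ⊨
  soundness ax-4 I w ρ (u , w≺u , v , u≺v , φ⊨) = v , ≺-trans w≺u u≺v , φ⊨
  soundness ax-◇∀ I w ρ (u , w≺u , φ⊨) d = u , w≺u , φ⊨ d
  soundness (r-∧ φ⊢ψ φ⊢χ) I w ρ φ⊨ = soundness φ⊢ψ I w ρ φ⊨ , soundness φ⊢χ I w ρ φ⊨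
  soundness (r-cut φ⊢ψ ψ⊢χ) I w ρ φ⊨ = soundness ψ⊢χ I w ρ (soundness φ⊢ψ I w ρ φ⊨)
  soundness (r-◇ φ⊢ψ) I w ρ (u , w≺u , φ⊨) = u , w≺u , soundness φ⊢ψ I u ρ φ⊨
  soundness (r-∀R {φ} {x = x} x∉φ φ⊢ψ) I w ρ φ⊨ d =
    soundness φ⊢ψ I w (ρ [ x ↦ d ]) (Sat-coincide φ (λ y y∈φ → sym (↦-≢ {ρ = ρ} {x} {d} λ { refl → x∉φ y∈φ })) φ⊨)
  soundness (r-∀L {φ} {x = x} {t} ff φ⊢ψ) I w ρ φ⊨ =
    soundness φ⊢ψ I w ρ (proj₂ (Sat-[≔] φ ff) (φ⊨ (eval I ρ t)))
  soundness (r-subst {φ} {ψ} ffφ ffψ φ⊢ψ) I w ρ φ⊨ =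
    proj₂ (Sat-[≔] ψ ffψ) (soundness φ⊢ψ I w _ (proj₁ (Sat-[≔] φ ffφ) φ⊨))
  soundness (r-const {φ} {ψ} {x} {c} c∉φ c∉ψ φ⊢ψ) I w ρ φ⊨ =
    Sat-const-irrelevant ψ {I = I′} c∉ψ (λ d d≢c → sym (I≡I′ d d≢c)) ψ⊨′
    where
    -- reinterpret c as ρ x, so that φ [ x ≔ const c ] and φ say the same
    I′ : ℕ → Domain
    I′ = I [ c ↦ ρ x ]
    I≡I′ : ∀ d → d ≢ c → I d ≡ I′ d
    I≡I′ d d≢c = sym (↦-≢ (d≢c ∘ sym))
    ρ≗ : ∀ z → (ρ [ x ↦ I′ c ]) z ≡ ρ z
    ρ≗ z = trans (cong (λ e → (ρ [ x ↦ e ]) z) (↦-≡ {ρ = I} {c} {ρ x} refl)) (↦-self {ρ = ρ} {x} z)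
    φ⊨′ : Sat I′ (φ [ x ≔ const c ]) w ρ
    φ⊨′ = proj₂ (Sat-[≔] φ (const-freeFor φ)) (Sat-≗ φ (sym ∘ ρ≗) (Sat-const-irrelevant φ c∉φ I≡I′ φ⊨))
    ψ⊨′ : Sat I′ ψ w ρ
    ψ⊨′ = Sat-≗ ψ {ρ = ρ [ x ↦ I′ c ]} ρ≗ (Sat-[≔const] ψ (soundness φ⊢ψ I′ w ρ φ⊨′))

  Sat-∀-instance : ∀ {x φ c I w ρ} → Sat I (∀ₒ x φ) w ρ → Sat I (φ [ x ≔ const c ]) w ρ
  Sat-∀-instance {φ = φ} {c} {I} φ⊨ = proj₂ (Sat-[≔] φ (const-freeFor φ)) (φ⊨ (I c))

-- The canonical model

module Unfolding (D : List ℕ) where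

  infix 4 _⊑_ _⇾_ _⇝_ _⊑?_ _⇝?_

  data _⊑_ : Formula → Formula → Set where
    ⊑-refl : ∀ {v} → v ⊑ v
    ⊑-∧ˡ : ∀ {χ φ ψ} → χ ⊑ φ → χ ⊑ φ ∧ ψ
    ⊑-∧ʳ : ∀ {χ φ ψ} → χ ⊑ ψ → χ ⊑ φ ∧ ψ
    ⊑-∀ : ∀ {χ x φ c} → c ∈ D → χ ⊑ φ [ x ≔ const c ] → χ ⊑ ∀ₒ x φ

  _⇾_ : Formula → Formula → Set
  v ⇾ u = ◇ u ⊑ v

  _⇝_ : Formula → Formula → Set
  _⇝_ = TransClosure _⇾_

  ⊑-trans : ∀ {χ ψ φ} → χ ⊑ ψ → ψ ⊑ φ → χ ⊑ φ
  ⊑-trans χ⊑ψ ⊑-refl = χ⊑ψ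
  ⊑-trans χ⊑ψ (⊑-∧ˡ ψ⊑φ) = ⊑-∧ˡ (⊑-trans χ⊑ψ ψ⊑φ)
  ⊑-trans χ⊑ψ (⊑-∧ʳ ψ⊑φ) = ⊑-∧ʳ (⊑-trans χ⊑ψ ψ⊑φ)
  ⊑-trans χ⊑ψ (⊑-∀ c∈D ψ⊑φ) = ⊑-∀ c∈D (⊑-trans χ⊑ψ ψ⊑φ)

  ⊑-conj : ∀ γ γs {φ} → φ ∈ γ ∷ γs → φ ⊑ conj γ γs
  ⊑-conj γ [] (here refl) = ⊑-refl
  ⊑-conj γ (δ ∷ δs) (here refl) = ⊑-∧ˡ ⊑-refl
  ⊑-conj γ (δ ∷ δs) (there φ∈) = ⊑-∧ʳ (⊑-conj δ δs φ∈)

  ⊑⇒∈Cl : ∀ {χ v} → χ ⊑ v → χ ∈Cl[ D ] v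
  ⊑⇒∈Cl ⊑-refl = cl-self
  ⊑⇒∈Cl (⊑-∧ˡ t) = cl-∧l (⊑⇒∈Cl t)
  ⊑⇒∈Cl (⊑-∧ʳ t) = cl-∧r (⊑⇒∈Cl t)
  ⊑⇒∈Cl (⊑-∀ c∈D t) = cl-∀ c∈D (⊑⇒∈Cl t)

  ⇾⇒∈Cl : ∀ {v u} → v ⇾ u → u ∈Cl[ D ] v
  ⇾⇒∈Cl s = ∈Cl-trans (cl-◇ cl-self) (⊑⇒∈Cl s)

  ⇝⇒◇∈Cl : ∀ {v u} → v ⇝ u → (◇ u) ∈Cl[ D ] v
  ⇝⇒◇∈Cl [ s ] = ⊑⇒∈Cl s
  ⇝⇒◇∈Cl (s ∷ r) = ∈Cl-trans (⇝⇒◇∈Cl r) (⇾⇒∈Cl s)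

  ⇝⇒∈Cl : ∀ {v u} → v ⇝ u → u ∈Cl[ D ] v
  ⇝⇒∈Cl r = ∈Cl-trans (cl-◇ cl-self) (⇝⇒◇∈Cl r)

  ⇝-md : ∀ {v u} → v ⇝ u → md u < md v
  ⇝-md r = ∈Cl-md (⇝⇒◇∈Cl r)

  ⊑-sound : ∀ {χ v} → χ ⊑ v → v ⊢ χ
  ⊑-sound ⊑-refl = ax-id
  ⊑-sound (⊑-∧ˡ t) = r-cut ax-∧l (⊑-sound t)
  ⊑-sound (⊑-∧ʳ t) = r-cut ax-∧r (⊑-sound t)
  ⊑-sound (⊑-∀ {φ = φ} _ t) = r-∀L (const-freeFor φ) (⊑-sound t)

  ⇝-sound : ∀ {v u} → v ⇝ u → v ⊢ ◇ u
  ⇝-sound [ s ] = ⊑-sound s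
  ⇝-sound (s ∷ r) = r-cut (⊑-sound s) (r-cut (r-◇ (⇝-sound r)) ax-4)

  ⊑-dec : ∀ n χ v → size v ≤ n → Dec (χ ⊑ v)
  ⊑-dec n χ v _ with χ ≟ᶠ v
  ... | yes refl = yes ⊑-refl
  ⊑-dec zero χ v le | no _ with ≤-trans (size-pos v) le
  ... | ()
  ⊑-dec (suc n) χ ⊤ₒ _ | no χ≢v = no λ { ⊑-refl → χ≢v refl }
  ⊑-dec (suc n) χ (atom _ _ _) _ | no χ≢v = no λ { ⊑-refl → χ≢v refl }
  ⊑-dec (suc n) χ (◇ _) _ | no χ≢v = no λ { ⊑-refl → χ≢v refl }
  ⊑-dec (suc n) χ (φ ∧ ψ) (s≤s le) | no χ≢v =
    map′ [ ⊑-∧ˡ , ⊑-∧ʳ ]′ (λ { ⊑-refl → ⊥-elim (χ≢v refl) ; (⊑-∧ˡ t) → inj₁ t ; (⊑-∧ʳ t) → inj₂ t })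
      (⊑-dec n χ φ (≤-trans (m≤m+n (size φ) (size ψ)) le) ⊎-dec ⊑-dec n χ ψ (≤-trans (m≤n+m (size ψ) (size φ)) le))
  ⊑-dec (suc n) χ (∀ₒ x φ) le | no χ≢v =
    map′ (λ a → let _ , c∈D , t = find a in ⊑-∀ c∈D t)
         (λ { ⊑-refl → ⊥-elim (χ≢v refl) ; (⊑-∀ c∈D t) → lose c∈D t })
         (any? (λ c → ⊑-dec n χ (φ [ x ≔ const c ]) (≤-pred (≤-trans (size-instance< φ x c) le))) D)

  _⊑?_ : ∀ χ v → Dec (χ ⊑ v)
  χ ⊑? v = ⊑-dec (size v) χ v ≤-refl

  ⇾-size : ∀ {v u} → v ⇾ u → size u < size v
  ⇾-size s = ∈Cl-size (⊑⇒∈Cl s)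

  ⇾-enumCl : ∀ {v u} → v ⇾ u → u ∈ enumCl D (size v) v
  ⇾-enumCl s = enumCl-complete _ (⇾⇒∈Cl s) ≤-refl

  ⇝-dec : ∀ n v u → size v ≤ n → Dec (v ⇝ u)
  ⇝-dec zero v u le with ≤-trans (size-pos v) le
  ... | ()
  ⇝-dec (suc n) v u le =
    map′ from to (any? successor? (enumCl D (size v) v))
    where
    Successor : Formula → Set
    Successor w = v ⇾ w × (w ≡ u ⊎ w ⇝ u)
    from : Any Successor (enumCl D (size v) v) → v ⇝ u
    from a with find a
    ... | _ , _ , s , inj₁ refl = [ s ]
    ... | _ , _ , s , inj₂ r = s ∷ r
    to : v ⇝ u → Any Successor (enumCl D (size v) v)
    to [ s ] = lose (⇾-enumCl s) (s , inj₁ refl)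
    to (s ∷ r) = lose (⇾-enumCl s) (s , inj₂ r)
    successor? : ∀ w → Dec (Successor w)
    successor? w with ◇ w ⊑? v
    ... | no ¬s = no (¬s ∘ proj₁)
    ... | yes s = map′ (s ,_) proj₂ (w ≟ᶠ u ⊎-dec ⇝-dec n w u (≤-pred (≤-trans (⇾-size s) le)))

  _⇝?_ : ∀ v u → Dec (v ⇝ u)
  v ⇝? u = ⇝-dec (size v) v u ≤-refl

module CanonicalModel (D : List ℕ) (d₀ : Fin (length D)) where
  open Unfolding D public

  name : Fin (length D) → Term
  name i = const (lookup D i)

  model : Model
  model = record
    { World = Formula
    ; _≺_ = _⇝_
    ; ≺-trans = Plus._++_
    ; Domain = Fin (length D)
    ; V = λ v n S ds → atom n S (Vec.map name ds) ⊑ v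
    }

  open Semantics model public

  I : ℕ → Fin (length D)
  I c with c ∈? D
  ... | yes c∈D = Any.index c∈D
  ... | no _ = d₀

  lookup-I : ∀ {c} → c ∈ D → lookup D (I c) ≡ c
  lookup-I {c} c∈D with c ∈? D
  ... | yes c∈D′ = sym (lookup-index c∈D′)
  ... | no c∉D = ⊥-elim (c∉D c∈D)

  ρ₀ : Env
  ρ₀ _ = d₀

  Sentence : Formula → Set
  Sentence φ = Closed φ × ConstsIn D φ

  Sentence-∈Cl : ∀ {ψ φ} → ψ ∈Cl[ D ] φ → Sentence φ → Sentence ψ
  Sentence-∈Cl h (closed , consts) = ∈Cl-closed h closed , ∈Cl-ConstsIn h consts

  Sentence-∧ : ∀ {φ ψ} → Sentence φ → Sentence ψ → Sentence (φ ∧ ψ)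
  Sentence-∧ (φ-closed , φ-consts) (ψ-closed , ψ-consts) =
    (λ { y (f-∧l y∈) → φ-closed y y∈ ; y (f-∧r y∈) → ψ-closed y y∈ }) , ConstsIn-∧ φ-consts ψ-consts

  name-eval-closed : ∀ {n S ρ} (ts : Vec Term n) → Sentence (atom n S ts) →
    Vec.map name (Vec.map (eval I ρ) ts) ≡ ts
  name-eval-closed {ρ = ρ} ts (closed , consts) =
    trans (sym (Vec.map-∘ name (eval I ρ) ts)) (trans (map-cong-∈ ts named) (Vec.map-id ts))
    where
    named : ∀ {u} → u Vec.∈ ts → name (eval I ρ u) ≡ u
    named {var y} y∈ts = ⊥-elim (closed y (f-atom y∈ts))
    named {const c} c∈ts = cong const (lookup-I (consts (c-atom c∈ts)))

  Sat-resp-lookup : ∀ φ {w ρ ρ′} → (∀ y → lookup D (ρ y) ≡ lookup D (ρ′ y)) → Sat I φ w ρ → Sat I φ w ρ′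
  Sat-resp-lookup ⊤ₒ _ _ = tt
  Sat-resp-lookup (atom n S ts) {w} {ρ} {ρ′} agree =
    subst (λ us → atom n S us ⊑ w)
      (trans (sym (Vec.map-∘ name (eval I ρ) ts)) (trans (Vec.map-cong named ts) (Vec.map-∘ name (eval I ρ′) ts)))
    where
    named : ∀ u → name (eval I ρ u) ≡ name (eval I ρ′ u)
    named (var y) = cong const (agree y)
    named (const c) = refl
  Sat-resp-lookup (φ ∧ ψ) agree (φ⊨ , ψ⊨) = Sat-resp-lookup φ agree φ⊨ , Sat-resp-lookup ψ agree ψ⊨
  Sat-resp-lookup (◇ φ) agree (u , r , φ⊨) = u , r , Sat-resp-lookup φ agree φ⊨
  Sat-resp-lookup (∀ₒ x φ) {ρ = ρ} {ρ′} agree φ⊨ d = Sat-resp-lookup φ agree′ (φ⊨ d)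
    where
    agree′ : ∀ y → lookup D ((ρ [ x ↦ d ]) y) ≡ lookup D ((ρ′ [ x ↦ d ]) y)
    agree′ y with x ≟ y
    ... | yes _ = refl
    ... | no _ = agree y

  Sat-instance : ∀ φ {x i v ρ} → Sat I (φ [ x ≔ name i ]) v ρ → Sat I φ v (ρ [ x ↦ i ])
  Sat-instance φ {x} {i} {v} {ρ} φ⊨ = Sat-resp-lookup φ agree (Sat-[≔const] φ φ⊨)
    where
    agree : ∀ y → lookup D ((ρ [ x ↦ I (lookup D i) ]) y) ≡ lookup D ((ρ [ x ↦ i ]) y)
    agree y with x ≟ y
    ... | yes _ = lookup-I (∈-lookup i)
    ... | no _ = refl

  ⊑⇒Sat : ∀ n χ {v ρ} → size χ ≤ n → Sentence χ → χ ⊑ v → Sat I χ v ρ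
  ⊑⇒Sat n ⊤ₒ _ _ _ = tt
  ⊑⇒Sat n (atom m S ts) {v} _ χs t = subst (_⊑ v) (cong (atom m S) (sym (name-eval-closed ts χs))) t
  ⊑⇒Sat (suc n) (φ ∧ ψ) (s≤s le) χs t =
    ⊑⇒Sat n φ (≤-trans (m≤m+n (size φ) (size ψ)) le) (Sentence-∈Cl (cl-∧l cl-self) χs) (⊑-trans (⊑-∧ˡ ⊑-refl) t) ,
    ⊑⇒Sat n ψ (≤-trans (m≤n+m (size ψ) (size φ)) le) (Sentence-∈Cl (cl-∧r cl-self) χs) (⊑-trans (⊑-∧ʳ ⊑-refl) t)
  ⊑⇒Sat (suc n) (◇ φ) (s≤s le) χs t = φ , [ t ] , ⊑⇒Sat n φ le (Sentence-∈Cl (cl-◇ cl-self) χs) ⊑-refl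
  ⊑⇒Sat (suc n) (∀ₒ x φ) le χs t i =
    Sat-instance φ (⊑⇒Sat n (φ [ x ≔ name i ]) (≤-pred (≤-trans (size-instance< φ x (lookup D i)) le))
      (Sentence-∈Cl (cl-∀ (∈-lookup i) cl-self) χs) (⊑-trans (⊑-∀ (∈-lookup i) ⊑-refl) t))

  Sat? : ∀ φ v ρ → Dec (Sat I φ v ρ)
  Sat? ⊤ₒ v ρ = yes tt
  Sat? (atom n S ts) v ρ = _ ⊑? v
  Sat? (φ ∧ ψ) v ρ = Sat? φ v ρ ×-dec Sat? ψ v ρ
  Sat? (◇ φ) v ρ = map′ from to (any? (λ u → v ⇝? u ×-dec Sat? φ u ρ) (enumCl D (size v) v))
    where
    from : Any (λ u → v ⇝ u × Sat I φ u ρ) (enumCl D (size v) v) → Sat I (◇ φ) v ρ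
    from a = let u , _ , r , φ⊨ = find a in u , r , φ⊨
    to : Sat I (◇ φ) v ρ → Any (λ u → v ⇝ u × Sat I φ u ρ) (enumCl D (size v) v)
    to (u , r , φ⊨) = lose (enumCl-complete _ (⇝⇒∈Cl r) ≤-refl) (r , φ⊨)
  Sat? (∀ₒ x φ) v ρ = Fin.all? (λ i → Sat? φ v (ρ [ x ↦ i ]))

  Sat⇒md≤ : ∀ φ {v ρ} → Sat I φ v ρ → md φ ≤ md v
  Sat⇒md≤ ⊤ₒ _ = z≤n
  Sat⇒md≤ (atom _ _ _) _ = z≤n
  Sat⇒md≤ (φ ∧ ψ) (φ⊨ , ψ⊨) = ⊔-lub (Sat⇒md≤ φ φ⊨) (Sat⇒md≤ ψ ψ⊨)
  Sat⇒md≤ (◇ φ) (u , r , φ⊨) = ≤-trans (s≤s (Sat⇒md≤ φ φ⊨)) (⇝-md r)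
  Sat⇒md≤ (∀ₒ x φ) φ⊨ = Sat⇒md≤ φ (φ⊨ d₀)

  record FreshFor (fs : List ℕ) (v ψ : Formula) : Set where
    field
      unique : Unique fs
      ⊆D : ∀ {f} → f ∈ fs → f ∈ D
      ∉v : ∀ {f} → f ∈ fs → ¬ ConstIn f v
      ∉ψ : ∀ {f} → f ∈ fs → ¬ ConstIn f ψ
      enough : qdepth v + qdepth ψ ≤ length fs

  FreshFor-sub : ∀ {fs v χ ψ} → qdepth χ ≤ qdepth ψ → (∀ {f} → ConstIn f χ → ConstIn f ψ) →
    FreshFor fs v ψ → FreshFor fs v χ
  FreshFor-sub {v = v} χ≤ψ χ⊆ψ fresh = record
    { unique = unique ; ⊆D = ⊆D ; ∉v = ∉v ; ∉ψ = λ f∈ → ∉ψ f∈ ∘ χ⊆ψ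
    ; enough = ≤-trans (+-monoʳ-≤ (qdepth v) χ≤ψ) enough }
    where open FreshFor fresh

  FreshFor-∀ : ∀ {f fs v x φ} → FreshFor (f ∷ fs) v (∀ₒ x φ) → FreshFor fs v (φ [ x ≔ const f ])
  FreshFor-∀ {f} {fs} {v} {x} {φ} fresh = record
    { unique = unique′ ; ⊆D = ⊆D ∘ there ; ∉v = ∉v ∘ there ; ∉ψ = ∉instance
    ; enough = ≤-pred (begin
        suc (qdepth v + qdepth (φ [ x ≔ const f ])) ≡⟨ cong (λ q → suc (qdepth v + q)) (qdepth-[≔] φ x (const f)) ⟩
        suc (qdepth v + qdepth φ)                   ≡⟨ +-suc (qdepth v) (qdepth φ) ⟨
        qdepth v + suc (qdepth φ)                   ≤⟨ enough ⟩
        suc (length fs)                             ∎) }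
    where
    open FreshFor fresh
    open ≤-Reasoning
    f∉fs : f ∉ fs
    unique′ : Unique fs
    f∉fs = Unique.Unique[x∷xs]⇒x∉xs unique
    unique′ with unique
    ... | _ ∷ fs! = fs!
    ∉instance : ∀ {g} → g ∈ fs → ¬ ConstIn g (φ [ x ≔ const f ])
    ∉instance g∈fs g∈φ with ConstIn-[≔const] φ g∈φ
    ... | inj₁ g∈∀φ = ∉ψ (there g∈fs) (c-∀ g∈∀φ)
    ... | inj₂ refl = f∉fs g∈fs

  FreshFor-⇝ : ∀ {fs v w φ} (r : v ⇝ w) → FreshFor fs v (◇ φ) →
    FreshFor (fs ∖ NewConstants.new (∈Cl-newConstants (⇝⇒∈Cl r))) w φ
  FreshFor-⇝ {fs} {v} {w} {φ} r fresh = record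
    { unique = ∖⁺ new unique
    ; ⊆D = ⊆D ∘ ∈-∖⁻ fs new
    ; ∉v = λ f∈ → [ ∉v (∈-∖⁻ fs new f∈) , ∉-∖ new unique f∈ ]′ ∘ cover
    ; ∉ψ = λ f∈ → ∉ψ (∈-∖⁻ fs new f∈) ∘ c-◇
    ; enough = +-cancelˡ-≤ (length new) _ _ (begin
        length new + (qdepth w + qdepth φ) ≡⟨ +-assoc (length new) (qdepth w) (qdepth φ) ⟨
        length new + qdepth w + qdepth φ   ≤⟨ +-monoˡ-≤ (qdepth φ) bound ⟩
        qdepth v + qdepth φ                ≤⟨ enough ⟩
        length fs                          ≤⟨ length-∖ fs new ⟩
        length new + length (fs ∖ new)     ∎) }
    where
    open FreshFor fresh
    open NewConstants (∈Cl-newConstants (⇝⇒∈Cl r))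
    open ≤-Reasoning

  completeness : ∀ n ψ {fs v ρ} → size ψ ≤ n → Sentence ψ → Sentence v → FreshFor fs v ψ →
    Sat I ψ v ρ → v ⊢ ψ
  completeness n ⊤ₒ _ _ _ _ _ = ax-⊤
  completeness n (atom m S ts) {v = v} _ ψs _ _ ψ⊨ =
    ⊑-sound (subst (_⊑ v) (cong (atom m S) (name-eval-closed ts ψs)) ψ⊨)
  completeness (suc n) (φ ∧ ψ) (s≤s le) χs vs fresh (φ⊨ , ψ⊨) =
    r-∧ (completeness n φ (≤-trans (m≤m+n (size φ) (size ψ)) le) (Sentence-∈Cl (cl-∧l cl-self) χs) vs
           (FreshFor-sub (m≤m⊔n _ _) c-∧l fresh) φ⊨)
        (completeness n ψ (≤-trans (m≤n+m (size ψ) (size φ)) le) (Sentence-∈Cl (cl-∧r cl-self) χs) vs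
           (FreshFor-sub (m≤n⊔m _ _) c-∧r fresh) ψ⊨)
  completeness (suc n) (◇ φ) (s≤s le) ψs vs fresh (w , r , φ⊨) =
    r-cut (⇝-sound r) (r-◇ (completeness n φ le (Sentence-∈Cl (cl-◇ cl-self) ψs) (Sentence-∈Cl (⇝⇒∈Cl r) vs)
                             (FreshFor-⇝ r fresh) φ⊨))
  completeness (suc n) (∀ₒ x φ) {[]} {v} _ _ _ fresh _
    with ≤-trans (m≤n+m (suc (qdepth φ)) (qdepth v)) (FreshFor.enough fresh)
  ... | ()
  completeness (suc n) (∀ₒ x φ) {f ∷ fs} {v} le ψs (v-closed , v-consts) fresh ψ⊨ =
    r-∀R (v-closed x) (r-const (∉v (here refl)) (∉ψ (here refl) ∘ c-∀)
      (subst (_⊢ φ [ x ≔ const f ]) (sym ([≔]-fresh v (v-closed x)))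
        (completeness n (φ [ x ≔ const f ]) (≤-pred (≤-trans (size-instance< φ x f) le))
          (Sentence-∈Cl (cl-∀ (⊆D (here refl)) cl-self) ψs) (v-closed , v-consts)
          (FreshFor-∀ fresh) (Sat-∀-instance {φ = φ} ψ⊨))))
    where open FreshFor fresh

  theory : Formula → List Formula → Pair
  theory v Ψ = ⟨ filter (λ φ → Sat? φ v ρ₀) Ψ , filter (λ φ → ¬? (Sat? φ v ρ₀)) Ψ ⟩

  module _ {v : Formula} {Ψ : List Formula} where

    ∈-theory⁺ : ∀ {φ} → φ ∈ Ψ → Sat I φ v ρ₀ → φ ∈ pos (theory v Ψ)
    ∈-theory⁺ = ∈-filter⁺ (λ φ → Sat? φ v ρ₀)

    ∈-theory⁻ : ∀ {φ} → φ ∈ Ψ → ¬ Sat I φ v ρ₀ → φ ∈ neg (theory v Ψ)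
    ∈-theory⁻ = ∈-filter⁺ (λ φ → ¬? (Sat? φ v ρ₀))

    theory⁺⇒Sat : ∀ {φ} → φ ∈ pos (theory v Ψ) → φ ∈ Ψ × Sat I φ v ρ₀
    theory⁺⇒Sat = ∈-filter⁻ (λ φ → Sat? φ v ρ₀)

    theory⁻⇒¬Sat : ∀ {φ} → φ ∈ neg (theory v Ψ) → φ ∈ Ψ × ¬ Sat I φ v ρ₀
    theory⁻⇒¬Sat = ∈-filter⁻ (λ φ → ¬? (Sat? φ v ρ₀))

    theory-inside : Inside (_∈ Ψ) (theory v Ψ)
    theory-inside = proj₁ ∘ theory⁺⇒Sat , proj₁ ∘ theory⁻⇒¬Sat

    theory-partition : ∀ {φ} → φ ∈ Ψ → φ ∈ pos (theory v Ψ) ⊎ φ ∈ neg (theory v Ψ)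
    theory-partition {φ} φ∈Ψ with Sat? φ v ρ₀
    ... | yes φ⊨ = inj₁ (∈-theory⁺ φ∈Ψ φ⊨)
    ... | no φ⊭ = inj₂ (∈-theory⁻ φ∈Ψ φ⊭)

    theory-consistent : Consistent (theory v Ψ)
    theory-consistent δ∈ (γ , γs , γ∈ , γs∈ , γs⊢δ) =
      proj₂ (theory⁻⇒¬Sat δ∈) (soundness γs⊢δ I v ρ₀ (conj-all _,_ γ γs (proj₂ ∘ theory⁺⇒Sat ∘ ∈pos)))
      where
      ∈pos : ∀ {φ} → φ ∈ γ ∷ γs → φ ∈ pos (theory v Ψ)
      ∈pos (here refl) = γ∈
      ∈pos (there φ∈γs) = All.lookup γs∈ φ∈γs

    theory-witnessed : (∀ {x φ c} → ∀ₒ x φ ∈ Ψ → c ∈ D → φ [ x ≔ const c ] ∈ Ψ) →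
      FullyWitnessed (theory v Ψ)
    theory-witnessed instances {x} {φ} ∀φ∈ =
      let ∀φ∈Ψ , ∀φ⊭ = theory⁻⇒¬Sat ∀φ∈
          i , φ⊭ = Fin.¬∀⟶∃¬ _ _ (λ i → Sat? φ v (ρ₀ [ x ↦ i ])) ∀φ⊭
      in lookup D i , ∈-theory⁻ (instances ∀φ∈Ψ (∈-lookup i)) (φ⊭ ∘ Sat-instance φ)

    theory-md : mdˢ (pos (theory v Ψ)) ≤ md v
    theory-md = maxOf-lub md _ (λ {φ} φ∈ → Sat⇒md≤ φ {v} {ρ₀} (proj₂ (theory⁺⇒Sat φ∈)))

-- Extending a pair

module Extension (Sig : Signature) (Φ : List Formula)
                 (Φ-sentences : All (λ φ → Closed φ × InLang (rels Sig) (consts Sig) φ) Φ) where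

  C : List ℕ
  C = consts Sig

  k : ℕ
  k = maxOf qdepth Φ

  -- completeness below uses at most k + k fresh constants; one more makes D nonempty
  fresh : List ℕ
  fresh = freshFrom (suc (maxOf id C)) (suc (k + k))

  D : List ℕ
  D = fresh ++ C

  open CanonicalModel D zero

  Ψ : List Formula
  Ψ = enumClˢ D Φ

  C⊆D : ∀ {c} → c ∈ C → c ∈ D
  C⊆D = ∈-++⁺ʳ fresh

  fresh-∉ : ∀ {f φ} → f ∈ fresh → ConstsIn C φ → ¬ ConstIn f φ
  fresh-∉ f∈ φ-consts f∈φ = <-irrefl refl (≤-trans (s≤s (≤-maxOf id (φ-consts f∈φ))) (freshFrom-≥ f∈))

  ClC⇒ClD : ∀ {ψ} → Cl C Φ ψ → Cl D Φ ψ
  ClC⇒ClD (φ , φ∈Φ , ψ∈φ) = φ , φ∈Φ , ∈Cl-mono C⊆D ψ∈φ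

  Cl-InLang : ∀ {ψ} → Cl D Φ ψ → InLang (rels Sig) D ψ
  Cl-InLang (φ , φ∈Φ , ψ∈φ) = ∈Cl-InLang ψ∈φ (InLang-mono C⊆D (proj₂ (All.lookup Φ-sentences φ∈Φ)))

  Cl-sentence : ∀ {ψ} → Cl D Φ ψ → Sentence ψ
  Cl-sentence (φ , φ∈Φ , ψ∈φ) =
    Sentence-∈Cl ψ∈φ (proj₁ (All.lookup Φ-sentences φ∈Φ) , InLang⇒ConstsIn (Cl-InLang (φ , φ∈Φ , cl-self)))

  Cl-qdepth : ∀ {ψ} → Cl D Φ ψ → qdepth ψ ≤ k
  Cl-qdepth (φ , φ∈Φ , ψ∈φ) = ≤-trans (∈Cl-qdepth ψ∈φ) (≤-maxOf qdepth φ∈Φ)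

  Ψ-instances : ∀ {x φ c} → ∀ₒ x φ ∈ Ψ → c ∈ D → φ [ x ≔ const c ] ∈ Ψ
  Ψ-instances ∀φ∈Ψ c∈D =
    let φ₀ , φ₀∈Φ , h = ∈-enumClˢ⁻ {Φ = Φ} ∀φ∈Ψ in ∈-enumClˢ⁺ (φ₀ , φ₀∈Φ , ∈Cl-trans (cl-∀ c∈D cl-self) h)

  Conclusion : Pair → Set
  Conclusion p = Σ (List ℕ) λ D → Σ Pair λ q →
    (∀ {c} → c ∈ consts Sig → c ∈ D) ×
    All (InLang (rels Sig) D) (pos q) ×
    All (InLang (rels Sig) D) (neg q) ×
    p ≤ₚ q ×
    MCW (Cl D Φ) q ×
    mdˢ (pos q) ≡ mdˢ (pos p)

  partition⇒conclusion : ∀ {p} q → Inside (_∈ Ψ) q → (∀ {φ} → φ ∈ Ψ → φ ∈ pos q ⊎ φ ∈ neg q) → Consistent q →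
    FullyWitnessed q → p ≤ₚ q → mdˢ (pos q) ≡ mdˢ (pos p) → Conclusion p
  partition⇒conclusion q (q⁺⊆Ψ , q⁻⊆Ψ) split q-consistent q-witnessed p≤q md≡ =
    D , q , C⊆D , All.tabulate (Cl-InLang ∘ ∈-enumClˢ⁻ ∘ q⁺⊆Ψ) , All.tabulate (Cl-InLang ∘ ∈-enumClˢ⁻ ∘ q⁻⊆Ψ) ,
    p≤q , (((∈-enumClˢ⁻ ∘ q⁺⊆Ψ , ∈-enumClˢ⁻ ∘ q⁻⊆Ψ) , q-consistent , partition⇒maximal q (split ∘ ∈-enumClˢ⁺)) ,
           q-witnessed) ,
    md≡

  -- Nothing is derivable from an empty p⁺, so all of Cl_D(Φ) can go to the negative side.
  extend-[] : ∀ ng → (∀ {δ} → δ ∈ ng → Cl C Φ δ) → Conclusion ⟨ [] , ng ⟩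
  extend-[] ng ng⊆Cl =
    partition⇒conclusion ⟨ [] , Ψ ⟩ ((λ ()) , id) inj₂ (λ { _ (_ , _ , () , _) })
      (λ ∀φ∈Ψ → lookup D zero , Ψ-instances ∀φ∈Ψ (∈-lookup zero)) ((λ ()) , ∈-enumClˢ⁺ ∘ ClC⇒ClD ∘ ng⊆Cl) refl

  extend-∷ : ∀ γ γs ng → All (InLang (rels Sig) C) (γ ∷ γs) → All (InLang (rels Sig) C) ng →
    Consistent ⟨ γ ∷ γs , ng ⟩ → Inside (Cl C Φ) ⟨ γ ∷ γs , ng ⟩ → Conclusion ⟨ γ ∷ γs , ng ⟩
  extend-∷ γ γs ng γs-lang ng-lang p-consistent (p⁺⊆Cl , p⁻⊆Cl) =
    partition⇒conclusion (theory v Ψ) theory-inside theory-partition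
      (theory-consistent {v} {Ψ}) (theory-witnessed {v} {Ψ} Ψ-instances)
      (p⁺⊆q⁺ , p⁻⊆q⁻) (≤-antisym md≤ (maxOf-mono md p⁺⊆q⁺))
    where
    v : Formula
    v = conj γ γs
    v-consts : ConstsIn C v
    v-consts = conj-all ConstsIn-∧ γ γs (InLang⇒ConstsIn ∘ All.lookup γs-lang)
    v-sentence : Sentence v
    v-sentence = conj-all Sentence-∧ γ γs (Cl-sentence ∘ ClC⇒ClD ∘ p⁺⊆Cl)
    v-qdepth : qdepth v ≤ k
    v-qdepth = conj-all ⊔-lub γ γs (Cl-qdepth ∘ ClC⇒ClD ∘ p⁺⊆Cl)
    md≤ : mdˢ (pos (theory v Ψ)) ≤ mdˢ (γ ∷ γs)
    md≤ = ≤-trans (theory-md {v} {Ψ}) (conj-all ⊔-lub γ γs (≤-maxOf md))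
    p⁺⊆q⁺ : ∀ {φ} → φ ∈ γ ∷ γs → φ ∈ pos (theory v Ψ)
    p⁺⊆q⁺ φ∈ = let φ∈Cl = ClC⇒ClD (p⁺⊆Cl φ∈) in
      ∈-theory⁺ (∈-enumClˢ⁺ φ∈Cl) (⊑⇒Sat _ _ ≤-refl (Cl-sentence φ∈Cl) (⊑-conj γ γs φ∈))
    p⁻⊆q⁻ : ∀ {δ} → δ ∈ ng → δ ∈ neg (theory v Ψ)
    p⁻⊆q⁻ δ∈ = let δ∈Cl = ClC⇒ClD (p⁻⊆Cl δ∈) in
      ∈-theory⁻ (∈-enumClˢ⁺ δ∈Cl) (λ δ⊨ →
        p-consistent δ∈ (γ , γs , here refl , All.tabulate there ,
          completeness _ _ ≤-refl (Cl-sentence δ∈Cl) v-sentence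
            (fresh-for-v (InLang⇒ConstsIn (All.lookup ng-lang δ∈)) (Cl-qdepth δ∈Cl)) δ⊨))
      where
      fresh-for-v : ∀ {δ} → ConstsIn C δ → qdepth δ ≤ k → FreshFor fresh v δ
      fresh-for-v δ-consts δ≤k = record
        { unique = freshFrom-unique _ _
        ; ⊆D = ∈-++⁺ˡ
        ; ∉v = λ f∈ → fresh-∉ f∈ v-consts
        ; ∉ψ = λ f∈ → fresh-∉ f∈ δ-consts
        ; enough = ≤-trans (≤-trans (+-mono-≤ v-qdepth δ≤k) (n≤1+n _)) (≤-reflexive (sym (length-freshFrom _ _)))
        }

open Extension using (extend-[]; extend-∷)

lemma5p5 : (Sig : Signature) (Φ : List Formula) →
    All (λ φ → Closed φ × InLang (rels Sig) (consts Sig) φ) Φ →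
    (p : Pair) →
    All (InLang (rels Sig) (consts Sig)) (pos p) →
    All (InLang (rels Sig) (consts Sig)) (neg p) →
    Consistent p →
    Inside (Cl (consts Sig) Φ) p →
    Σ (List ℕ) λ D → Σ Pair λ q →
      (∀ {c} → c ∈ consts Sig → c ∈ D) ×
      All (InLang (rels Sig) D) (pos q) ×
      All (InLang (rels Sig) D) (neg q) ×
      p ≤ₚ q ×
      MCW (Cl D Φ) q ×
      mdˢ (pos q) ≡ mdˢ (pos p)
lemma5p5 Sig Φ Φ-sentences ⟨ [] , ng ⟩ _ _ _ (_ , ng⊆Cl) = extend-[] Sig Φ Φ-sentences ng ng⊆Cl
lemma5p5 Sig Φ Φ-sentences ⟨ γ ∷ γs , ng ⟩ γs-lang ng-lang p-consistent p-inside =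
  extend-∷ Sig Φ Φ-sentences γ γs ng γs-lang ng-lang p-consistent p-inside
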